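{- $Q_{132}^{(0,0,0,0)}(t,x)=C(xt)=\frac{1-\sqrt{1-4xt}}{2xt}$, and for every $k\ge 1$, $$Q_{132}^{(k,0,0,0)}(t,x)=\frac{1}{1-t\,Q_{132}^{(k-1,0,0,0)}(t,x)}.$$
   Context: For $\sigma=\sigma_1\cdots\sigma_n\in S_n$ and a position $i$: $\sigma_i$ matches $MMP(a,b,c,d)$ ($a,b,c,d\in\mathbb{N}$) if there are at least $a$ indices $j>i$ with $\sigma_j>\sigma_i$, at least $b$ indices $j<i$ with $\sigma_j>\sigma_i$, at least $c$ indices $j<i$ with $\sigma_j<\sigma_i$, and at least $d$ indices $j>i$ with $\sigma_j<\sigma_i$; $\mathrm{mmp}^{(a,b,c,d)}(\sigma)$ is the number of such $i$. $S_n(132)$ is the set of 132-avoiding permutations of $[n]$. $Q_{n,132}^{(a,b,c,d)}(x)=\sum_{\sigma\in S_n(132)}x^{\mathrm{mmp}^{(a,b,c,d)}(\sigma)}$ and $Q_{132}^{(a,b,c,d)}(t,x)=1+\sum_{n\ge1}t^nQ_{n,132}^{(a,b,c,d)}(x)$ as a formal power series. $C(t)=\sum_{n\ge0}C_nt^n=\frac{1-\sqrt{1-4t}}{2t}$ with $C_n=\frac{1}{n+1}\binom{2n}{n}$ the Catalan numbers. -}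

module Defs where

open import Data.Bool using (Bool; true; false; _∧_; _∨_; not; if_then_else_)
open import Data.Nat using (ℕ; zero; suc; _∸_; _/_; _<ᵇ_; _≤ᵇ_; _≡ᵇ_)
import Data.Nat as ℕ
open import Data.Nat.Combinatorics using (_C_)
open import Data.List using (List; []; _∷_; map; concatMap; upTo; length)
open import Data.Integer using (ℤ; +_; _+_; _*_; _-_)
open import Relation.Binary.PropositionalEquality using (_≡_)

-- Words / permutations (values in {0,…,n-1} instead of {1,…,n};
-- pattern notions depend only on relative order)

countB : (ℕ → Bool) → List ℕ → ℕ
countB p []       = 0
countB p (x ∷ xs) = if p x then suc (countB p xs) else countB p xs

anyB : (ℕ → Bool) → List ℕ → Bool
anyB p []       = false
anyB p (x ∷ xs) = p x ∨ anyB p xs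

filterB : (ℕ → Bool) → List ℕ → List ℕ
filterB p []       = []
filterB p (x ∷ xs) = if p x then x ∷ filterB p xs else filterB p xs

words : ℕ → ℕ → List (List ℕ)
words zero    n = [] ∷ []
words (suc k) n = concatMap (λ v → map (v ∷_) (words k n)) (upTo n)

distinct : List ℕ → Bool
distinct []       = true
distinct (x ∷ xs) = not (anyB (λ y → x ≡ᵇ y) xs) ∧ distinct xs

-- a word of length n over {0,…,n-1} with distinct entries is a permutation
isPerm : ℕ → List ℕ → Bool
isPerm n w = (length w ≡ᵇ n) ∧ distinct w

has21 : List ℕ → Bool
has21 []       = false
has21 (y ∷ zs) = anyB (λ z → z <ᵇ y) zs ∨ has21 zs

-- contains 132: i<j<k with w_i < w_k < w_j
contains132 : List ℕ → Bool
contains132 []       = false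
contains132 (x ∷ rest) = has21 (filterB (λ y → x <ᵇ y) rest) ∨ contains132 rest

avoids132 : List ℕ → Bool
avoids132 w = not (contains132 w)

matchesMMP : ℕ → ℕ → ℕ → ℕ → List ℕ → ℕ → List ℕ → Bool
matchesMMP a b c d pre v post =
  (a ≤ᵇ countB (λ y → v <ᵇ y) post) ∧
  (b ≤ᵇ countB (λ y → v <ᵇ y) pre) ∧
  (c ≤ᵇ countB (λ y → y <ᵇ v) pre) ∧
  (d ≤ᵇ countB (λ y → y <ᵇ v) post)

mmpGo : ℕ → ℕ → ℕ → ℕ → List ℕ → List ℕ → ℕ
mmpGo a b c d pre []         = 0
mmpGo a b c d pre (v ∷ post) =
  (if matchesMMP a b c d pre v post then 1 else 0) ℕ.+ mmpGo a b c d (v ∷ pre) post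

mmp : ℕ → ℕ → ℕ → ℕ → List ℕ → ℕ
mmp a b c d σ = mmpGo a b c d [] σ

-- coefficient of x^m in Q_{n,132}^{(a,b,c,d)}(x):
-- #{ σ ∈ S_n(132) : mmp^{(a,b,c,d)}(σ) = m }
countQ : ℕ → ℕ → ℕ → ℕ → List (List ℕ) → ℕ → ℕ → ℕ
countQ a b c d []       n m = 0
countQ a b c d (w ∷ ws) n m =
  if isPerm n w ∧ avoids132 w ∧ (mmp a b c d w ≡ᵇ m)
  then suc (countQ a b c d ws n m) else countQ a b c d ws n m

Qcoeff : ℕ → ℕ → ℕ → ℕ → ℕ → ℕ → ℕ
Qcoeff a b c d n m = countQ a b c d (words n n) n m

-- Formal power series in t, x over ℤ: coefficient of t^n x^m

Series : Set
Series = ℕ → ℕ → ℤ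

_≈ˢ_ : Series → Series → Set
f ≈ˢ g = ∀ n m → f n m ≡ g n m

sumTo : ℕ → (ℕ → ℤ) → ℤ
sumTo zero    f = f zero
sumTo (suc n) f = sumTo n f + f (suc n)

_*ˢ_ : Series → Series → Series
(f *ˢ g) n m = sumTo n (λ i → sumTo m (λ j → f i j * g (n ∸ i) (m ∸ j)))

_-ˢ_ : Series → Series → Series
(f -ˢ g) n m = f n m - g n m

oneˢ : Series
oneˢ zero zero = + 1
oneˢ _    _    = + 0

tˢ : Series
tˢ (suc zero) zero = + 1
tˢ _          _    = + 0

-- Q_{132}^{(a,b,c,d)}(t,x) = 1 + Σ_{n≥1} t^n Q_{n,132}(x)
-- (the n = 0 term of Qcoeff is 1, from the empty permutation)
Q132 : ℕ → ℕ → ℕ → ℕ → Series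
Q132 a b c d n m = + Qcoeff a b c d n m

catalan : ℕ → ℕ
catalan n = ((2 ℕ.* n) C n) / suc n

-- C(xt) = Σ_n C_n x^n t^n
Cxt : Series
Cxt n m = if n ≡ᵇ m then + catalan n else + 0

module Submission where

-- Every 132-avoiding permutation of {0,…,n} is uniquely (α + i) n β, where β avoids
-- 132 on {0,…,i-1} and α on {0,…,n-i-1}. Statistic shows
-- that mmp^{(k+1,0,0,0)} (positions with at least k+1 larger entries to their right)
-- splits as mmp^{(k)}(α) + mmp^{(k+1)}(β). Coefficients transfers the coefficients of Q
-- (defined by filtering all words) to counts over the list and, with the convolution
-- identity of NatSums, derives Q_{k+1} = 1 + t·Q_{k+1}·Q_k, which SeriesAlgebra turns into
-- Q_{k+1}·(1 - t·Q_k) = 1. For k = 0 the statistic is the size, so Q_0 is diagonal with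
-- coefficients obeying the Catalan recurrence; CatalanClosedForm (a telescoping argument
-- with CentralBinomial and IntegerSums) solves it as C(2n,n)/(n+1).

open import Defs
open import Data.Nat using (ℕ; suc)
open import Data.Product using (_×_; _,_)

module ListCounting where

  open import Data.Bool using (Bool; true; false; T)
  open import Data.Nat using (ℕ; suc; _+_; _≤_; z≤n; s≤s)
  open import Data.Nat.Properties using (≤-antisym; +-suc)
  open import Data.List using (List; []; _∷_; _++_; map; concatMap; length; filterᵇ)
  open import Data.Nat.ListAction using (sum)
  open import Data.List.Properties using (length-++; filter-++)
  open import Data.List.Membership.Propositional using (_∈_; find)
  open import Data.List.Membership.Propositional.Properties
    using (∈-∃++; ∈-++⁻; ∈-++⁺ˡ; ∈-++⁺ʳ; ∈-filter⁺; ∈-filter⁻; ∈-concatMap⁻; ∈-map⁻)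
  open import Data.List.Relation.Binary.Subset.Propositional using (_⊆_)
  open import Data.List.Relation.Unary.Any using (here; there)
  import Data.List.Relation.Unary.All as All
  open import Data.List.Relation.Unary.AllPairs using ([]; _∷_)
  open import Data.List.Relation.Unary.Unique.Propositional using (Unique)
  open import Data.List.Relation.Unary.Unique.Propositional.Properties using (++⁺; filter⁺)
  open import Data.Product using (_×_; _,_)
  open import Data.Sum using (inj₁; inj₂)
  open import Data.Empty using (⊥; ⊥-elim)
  open import Relation.Nullary.Decidable using (T?)
  open import Function using (_∘_)
  open import Relation.Binary.PropositionalEquality

  module _ {a} {A : Set a} where

    unique-⊆-length : ∀ {xs ys : List A} → Unique xs → xs ⊆ ys → length xs ≤ length ys
    unique-⊆-length {[]} _ _ = z≤n
    unique-⊆-length {x ∷ xs} {ys} (x∉xs ∷ xs!) xs⊆ys with ∈-∃++ (xs⊆ys (here refl))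
    ... | us , vs , refl = subst (suc (length xs) ≤_) (sym length-split)
                             (s≤s (unique-⊆-length xs! xs⊆us++vs))
      where
      length-split : length (us ++ x ∷ vs) ≡ suc (length (us ++ vs))
      length-split = begin
        length (us ++ x ∷ vs)       ≡⟨ length-++ us ⟩
        length us + suc (length vs) ≡⟨ +-suc (length us) (length vs) ⟩
        suc (length us + length vs) ≡⟨ cong suc (length-++ us) ⟨
        suc (length (us ++ vs))     ∎
        where open ≡-Reasoning
      xs⊆us++vs : xs ⊆ us ++ vs
      xs⊆us++vs {z} z∈xs with ∈-++⁻ us (xs⊆ys (there z∈xs))
      ... | inj₁ z∈us        = ∈-++⁺ˡ z∈us
      ... | inj₂ (here refl) = ⊥-elim (All.lookup x∉xs z∈xs refl)
      ... | inj₂ (there z∈vs) = ∈-++⁺ʳ us z∈vs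

    unique-++⁻ : ∀ xs {ys : List A} → Unique (xs ++ ys) → Unique xs × Unique ys × (∀ {z} → z ∈ xs → z ∈ ys → ⊥)
    unique-++⁻ []       ys!           = [] , ys! , λ ()
    unique-++⁻ (x ∷ xs) (x∉ ∷ xsys!) with unique-++⁻ xs xsys!
    ... | xs! , ys! , disjoint =
      All.tabulate (λ z∈ → All.lookup x∉ (∈-++⁺ˡ z∈)) ∷ xs! , ys! , λ
        { (here refl) z∈ys → All.lookup x∉ (∈-++⁺ʳ xs z∈ys) refl
        ; (there z∈xs) z∈ys → disjoint z∈xs z∈ys }

    count : (A → Bool) → List A → ℕ
    count p xs = length (filterᵇ p xs)

    -- Two repetition-free lists with the same members passing p have the same
    -- number of such members; this is how a count over one enumeration of a
    -- finite set is transferred to another.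
    count-unique-≡ : ∀ p {xs ys} → Unique xs → Unique ys →
                     (∀ {z} → T (p z) → z ∈ xs → z ∈ ys) →
                     (∀ {z} → T (p z) → z ∈ ys → z ∈ xs) →
                     count p xs ≡ count p ys
    count-unique-≡ p xs! ys! xs→ys ys→xs =
      ≤-antisym (unique-⊆-length (filter⁺ (T? ∘ p) xs!) (filter-⊆ xs→ys))
                (unique-⊆-length (filter⁺ (T? ∘ p) ys!) (filter-⊆ ys→xs))
      where
      filter-⊆ : ∀ {us vs} → (∀ {z} → T (p z) → z ∈ us → z ∈ vs) → filterᵇ p us ⊆ filterᵇ p vs
      filter-⊆ us→vs z∈ with ∈-filter⁻ (T? ∘ p) z∈
      ... | z∈us , pz = ∈-filter⁺ (T? ∘ p) (us→vs pz z∈us) pz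

    count-++ : ∀ p xs ys → count p (xs ++ ys) ≡ count p xs + count p ys
    count-++ p xs ys = trans (cong length (filter-++ (T? ∘ p) xs ys)) (length-++ (filterᵇ p xs))

    count-cong : ∀ p q xs → (∀ {z} → z ∈ xs → p z ≡ q z) → count p xs ≡ count q xs
    count-cong p q [] _ = refl
    count-cong p q (x ∷ xs) p≗q with p x | q x | p≗q (here refl)
    ... | true  | true  | refl = cong suc (count-cong p q xs (p≗q ∘ there))
    ... | false | false | refl = count-cong p q xs (p≗q ∘ there)

    count-none : ∀ p xs → (∀ {z} → z ∈ xs → p z ≡ false) → count p xs ≡ 0
    count-none p []       _      = refl
    count-none p (x ∷ xs) p≡false rewrite p≡false (here refl) = count-none p xs (p≡false ∘ there)

    count-const-true : ∀ xs → count (λ _ → true) xs ≡ length xs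
    count-const-true []       = refl
    count-const-true (x ∷ xs) = cong suc (count-const-true xs)

  module _ {a b} {A : Set a} {B : Set b} where

    count-map : ∀ (p : B → Bool) (f : A → B) xs → count p (map f xs) ≡ count (p ∘ f) xs
    count-map p f [] = refl
    count-map p f (x ∷ xs) with p (f x)
    ... | true  = cong suc (count-map p f xs)
    ... | false = count-map p f xs

    count-concatMap : ∀ (p : B → Bool) (F : A → List B) xs →
                      count p (concatMap F xs) ≡ sum (map (count p ∘ F) xs)
    count-concatMap p F []       = refl
    count-concatMap p F (x ∷ xs) =
      trans (count-++ p (F x) (concatMap F xs)) (cong (count p (F x) +_) (count-concatMap p F xs))

    map-unique-on : ∀ (f : A → B) {xs} → (∀ {x y} → x ∈ xs → y ∈ xs → f x ≡ f y → x ≡ y) →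
                    Unique xs → Unique (map f xs)
    map-unique-on f {[]}     _   _             = []
    map-unique-on f {x ∷ xs} inj (x∉xs ∷ xs!) =
      All.tabulate fx∉ ∷ map-unique-on f (λ p q → inj (there p) (there q)) xs!
      where
      fx∉ : ∀ {z} → z ∈ map f xs → f x ≢ z
      fx∉ z∈ fx≡z with ∈-map⁻ f z∈
      ... | y , y∈xs , z≡fy = All.lookup x∉xs y∈xs (inj (here refl) (there y∈xs) (trans fx≡z z≡fy))

    concatMap-unique : ∀ (F : A → List B) {xs} → Unique xs →
                       (∀ {x} → x ∈ xs → Unique (F x)) →
                       (∀ {x y z} → x ∈ xs → y ∈ xs → z ∈ F x → z ∈ F y → x ≡ y) →
                       Unique (concatMap F xs)
    concatMap-unique F {[]} _ _ _ = []
    concatMap-unique F {x ∷ xs} (x∉xs ∷ xs!) F! tag =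
      ++⁺ (F! (here refl)) (concatMap-unique F xs! (F! ∘ there) (λ p q → tag (there p) (there q))) disjoint
      where
      disjoint : ∀ {z} → z ∈ F x × z ∈ concatMap F xs → ⊥
      disjoint (z∈Fx , z∈rest) with find (∈-concatMap⁻ F z∈rest)
      ... | y , y∈xs , z∈Fy = All.lookup x∉xs y∈xs (tag (here refl) (there y∈xs) z∈Fx z∈Fy)

module BooleanTests where

  open import Data.Bool using (true; false; _∨_; _∧_)
  open import Data.Bool.Properties using (∨-zeroʳ)
  open import Data.Nat using (_<ᵇ_; _≡ᵇ_; _≤_; _<_; _≟_; _<?_)
  open import Data.Nat.Properties using (≤⇒≯)
  open import Relation.Nullary.Decidable using (dec-true; dec-false)
  open import Data.Product using (_×_; _,_)
  open import Data.Empty using (⊥; ⊥-elim)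
  open import Relation.Binary.PropositionalEquality using (_≡_; _≢_; refl)

  <ᵇ-true : ∀ {m n} → m < n → (m <ᵇ n) ≡ true
  <ᵇ-true {m} {n} = dec-true (m <? n)

  <ᵇ-false : ∀ {m n} → n ≤ m → (m <ᵇ n) ≡ false
  <ᵇ-false {m} {n} n≤m = dec-false (m <? n) (≤⇒≯ n≤m)

  ≡ᵇ-true : ∀ {m n} → m ≡ n → (m ≡ᵇ n) ≡ true
  ≡ᵇ-true {m} {n} = dec-true (m ≟ n)

  ≡ᵇ-false : ∀ {m n} → m ≢ n → (m ≡ᵇ n) ≡ false
  ≡ᵇ-false {m} {n} = dec-false (m ≟ n)

  ∨-true-left : ∀ {a} b → a ≡ true → (a ∨ b) ≡ true
  ∨-true-left b refl = refl

  ∨-true-right : ∀ a {b} → b ≡ true → (a ∨ b) ≡ true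
  ∨-true-right a refl = ∨-zeroʳ a

  ∨-false : ∀ {a b} → (a ∨ b) ≡ false → a ≡ false × b ≡ false
  ∨-false {false} {false} _ = refl , refl

  ∧-true : ∀ {a b} → (a ∧ b) ≡ true → a ≡ true × b ≡ true
  ∧-true {true} {true} _ = refl , refl

  both-ways : ∀ {b} → b ≡ true → b ≡ false → ⊥
  both-ways refl ()

  contraposeᵇ : ∀ {b c} → (b ≡ true → c ≡ true) → c ≡ false → b ≡ false
  contraposeᵇ {false} _    _   = refl
  contraposeᵇ {true}  b⇒c c≡f = ⊥-elim (both-ways (b⇒c refl) c≡f)

module Pattern132 where

  open BooleanTests
  open import Data.Bool using (true; false; _∨_)
  open import Data.Bool.Properties using (∨-assoc; ∨-identityʳ)
  open import Data.Nat using (ℕ; zero; suc; _+_; _<ᵇ_; _≤_; _<_)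
  open import Data.Nat.Properties using (<-trans; <⇒≤; <-≤-trans)
  open import Data.List using ([]; _∷_; _++_; map; [_])
  open import Data.List.Membership.Propositional using (_∈_)
  open import Data.List.Relation.Unary.Any using (here; there)
  open import Data.List.Relation.Unary.All as All using (All; []; _∷_)
  open import Data.Product using (_,_)
  open import Relation.Binary.PropositionalEquality using (_≡_; refl; sym; trans; cong; cong₂)

  anyB-++ : ∀ p xs ys → anyB p (xs ++ ys) ≡ (anyB p xs ∨ anyB p ys)
  anyB-++ p []       ys = refl
  anyB-++ p (x ∷ xs) ys = trans (cong (p x ∨_) (anyB-++ p xs ys)) (sym (∨-assoc (p x) _ _))

  anyB-none : ∀ p {xs} → All (λ x → p x ≡ false) xs → anyB p xs ≡ false
  anyB-none p []              = refl
  anyB-none p (px≡false ∷ ps) = cong₂ _∨_ px≡false (anyB-none p ps)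

  anyB-none⁻ : ∀ p xs → anyB p xs ≡ false → All (λ x → p x ≡ false) xs
  anyB-none⁻ p []       _    = []
  anyB-none⁻ p (x ∷ xs) none = let (px , rest) = ∨-false {p x} none in px ∷ anyB-none⁻ p xs rest

  anyB-∈ : ∀ p {xs y} → y ∈ xs → p y ≡ true → anyB p xs ≡ true
  anyB-∈ p {x ∷ xs} (here refl) py = ∨-true-left _ py
  anyB-∈ p {x ∷ xs} (there y∈)  py = ∨-true-right (p x) (anyB-∈ p y∈ py)

  filterB-++ : ∀ p xs ys → filterB p (xs ++ ys) ≡ filterB p xs ++ filterB p ys
  filterB-++ p []       ys = refl
  filterB-++ p (x ∷ xs) ys with p x
  ... | true  = cong (x ∷_) (filterB-++ p xs ys)
  ... | false = filterB-++ p xs ys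

  filterB-none : ∀ p {xs} → All (λ x → p x ≡ false) xs → filterB p xs ≡ []
  filterB-none p []              = refl
  filterB-none p (px≡false ∷ ps) rewrite px≡false = filterB-none p ps

  filterB-∈ : ∀ p {xs y} → y ∈ xs → p y ≡ true → y ∈ filterB p xs
  filterB-∈ p {x ∷ xs} (here refl) py rewrite py = here refl
  filterB-∈ p {x ∷ xs} (there y∈)  py with p x
  ... | true  = there (filterB-∈ p y∈ py)
  ... | false = filterB-∈ p y∈ py

  filterB-All : ∀ p {P : ℕ → Set} {xs} → All P xs → All P (filterB p xs)
  filterB-All p []                    = []
  filterB-All p {xs = x ∷ xs} (Px ∷ Ps) with p x
  ... | true  = Px ∷ filterB-All p Ps
  ... | false = filterB-All p Ps

  has21-snoc-max : ∀ L n → All (_< n) L → has21 (L ++ [ n ]) ≡ has21 L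
  has21-snoc-max []       n _ = refl
  has21-snoc-max (y ∷ zs) n (y<n ∷ zs<n)
    rewrite anyB-++ (_<ᵇ y) zs [ n ] | <ᵇ-false (<⇒≤ y<n) | has21-snoc-max zs n zs<n
    = cong (_∨ has21 zs) (∨-identityʳ _)

  has21-++ˡ : ∀ L M → has21 L ≡ true → has21 (L ++ M) ≡ true
  has21-++ˡ (y ∷ zs) M h with anyB (_<ᵇ y) zs in descent
  ... | true  rewrite anyB-++ (_<ᵇ y) zs M | descent = refl
  ... | false = ∨-true-right (anyB (_<ᵇ y) (zs ++ M)) (has21-++ˡ zs M h)

  has21-descent : ∀ us n vs y → y ∈ vs → y < n → has21 (us ++ n ∷ vs) ≡ true
  has21-descent []       n vs y y∈ y<n = ∨-true-left _ (anyB-∈ (_<ᵇ n) y∈ (<ᵇ-true y<n))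
  has21-descent (u ∷ us) n vs y y∈ y<n = ∨-true-right _ (has21-descent us n vs y y∈ y<n)

  contains132-++ˡ : ∀ xs zs → contains132 xs ≡ true → contains132 (xs ++ zs) ≡ true
  contains132-++ˡ (x ∷ xs) zs h with has21 (filterB (x <ᵇ_) xs) in above
  ... | true  rewrite filterB-++ (x <ᵇ_) xs zs = ∨-true-left _ (has21-++ˡ (filterB (x <ᵇ_) xs) _ above)
  ... | false = ∨-true-right _ (contains132-++ˡ xs zs h)

  contains132-++ʳ : ∀ xs zs → contains132 zs ≡ true → contains132 (xs ++ zs) ≡ true
  contains132-++ʳ []       zs h = h
  contains132-++ʳ (x ∷ xs) zs h = ∨-true-right _ (contains132-++ʳ xs zs h)

  contains132-witness : ∀ xs n ys x y → x ∈ xs → y ∈ ys → x < y → y < n →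
                        contains132 (xs ++ n ∷ ys) ≡ true
  contains132-witness (x ∷ xs) n ys .x y (here refl) y∈ x<y y<n
    rewrite filterB-++ (x <ᵇ_) xs (n ∷ ys) | <ᵇ-true (<-trans x<y y<n)
    = ∨-true-left _ (has21-descent (filterB (x <ᵇ_) xs) n _ y (filterB-∈ _ y∈ (<ᵇ-true x<y)) y<n)
  contains132-witness (_ ∷ xs) n ys x y (there x∈) y∈ x<y y<n =
    ∨-true-right _ (contains132-witness xs n ys x y x∈ y∈ x<y y<n)

  contains132-glue : ∀ xs n ys i → All (_< n) xs → All (i ≤_) xs → All (_< i) ys → All (_< n) ys →
                     contains132 xs ≡ false → contains132 ys ≡ false →
                     contains132 (xs ++ n ∷ ys) ≡ false
  contains132-glue [] n ys i _ _ _ ys<n _ ys-avoids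
    rewrite filterB-none (n <ᵇ_) (All.map (λ y<n → <ᵇ-false (<⇒≤ y<n)) ys<n) = ys-avoids
  contains132-glue (x ∷ xs) n ys i (x<n ∷ xs<n) (i≤x ∷ i≤xs) ys<i ys<n xs-avoids ys-avoids
    rewrite filterB-++ (x <ᵇ_) xs (n ∷ ys) | <ᵇ-true x<n
          | filterB-none (x <ᵇ_) (All.map (λ y<i → <ᵇ-false (<⇒≤ (<-≤-trans y<i i≤x))) ys<i)
    = let (no21 , rest) = ∨-false {has21 (filterB (x <ᵇ_) xs)} xs-avoids in
      cong₂ _∨_ (trans (has21-snoc-max _ n (filterB-All (x <ᵇ_) xs<n)) no21)
                (contains132-glue xs n ys i xs<n i≤xs ys<i ys<n rest ys-avoids)

  module OrderPreserving (f : ℕ → ℕ) (f-<ᵇ : ∀ x y → (f x <ᵇ f y) ≡ (x <ᵇ y)) where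

    anyB-below-map : ∀ y zs → anyB (_<ᵇ f y) (map f zs) ≡ anyB (_<ᵇ y) zs
    anyB-below-map y []       = refl
    anyB-below-map y (z ∷ zs) = cong₂ _∨_ (f-<ᵇ z y) (anyB-below-map y zs)

    has21-map : ∀ zs → has21 (map f zs) ≡ has21 zs
    has21-map []       = refl
    has21-map (y ∷ zs) = cong₂ _∨_ (anyB-below-map y zs) (has21-map zs)

    filterB-above-map : ∀ x zs → filterB (f x <ᵇ_) (map f zs) ≡ map f (filterB (x <ᵇ_) zs)
    filterB-above-map x []       = refl
    filterB-above-map x (z ∷ zs) rewrite f-<ᵇ x z with x <ᵇ z
    ... | true  = cong (f z ∷_) (filterB-above-map x zs)
    ... | false = filterB-above-map x zs

    contains132-map : ∀ w → contains132 (map f w) ≡ contains132 w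
    contains132-map []      = refl
    contains132-map (x ∷ w) = cong₂ _∨_
      (trans (cong has21 (filterB-above-map x w)) (has21-map (filterB (x <ᵇ_) w)))
      (contains132-map w)

  +-<ᵇ : ∀ i x y → ((i + x) <ᵇ (i + y)) ≡ (x <ᵇ y)
  +-<ᵇ zero    x y = refl
  +-<ᵇ (suc i) x y = +-<ᵇ i x y

  contains132-shift : ∀ i w → contains132 (map (i +_) w) ≡ contains132 w
  contains132-shift i = OrderPreserving.contains132-map (i +_) (+-<ᵇ i)

module Enumeration where

  open ListCounting
  open BooleanTests
  open Pattern132
  open import Data.Bool using (false)
  open import Data.Nat using (ℕ; zero; suc; _+_; _∸_; _≤_; _<_; s≤s)
  open import Data.Nat.Properties
  open import Data.List using (List; []; _∷_; _++_; [_]; map; concatMap; upTo; length)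
  open import Data.List.Properties using (length-++; length-map; length-upTo; map-injective; ∷-injective; ∷-injectiveˡ)
  open import Data.List.Membership.Propositional using (_∈_; _∉_; find; lose)
  open import Data.List.Membership.Propositional.Properties
    using (∈-∃++; ∈-map⁺; ∈-map⁻; ∈-concatMap⁺; ∈-concatMap⁻; ∈-upTo⁺; ∈-upTo⁻)
  open import Data.List.Relation.Unary.Any using (here; there)
  open import Data.List.Relation.Unary.All as All using (All; []; _∷_)
  import Data.List.Relation.Unary.All.Properties as All
  open import Data.List.Relation.Unary.AllPairs using ([]; _∷_)
  open import Data.List.Relation.Unary.Unique.Propositional using (Unique)
  open import Data.List.Relation.Unary.Unique.Propositional.Properties using (++⁺; map⁺; map⁻; upTo⁺)
  open import Data.Product using (∃; ∃₂; _×_; _,_; proj₁; proj₂)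
  open import Data.Empty using (⊥; ⊥-elim)
  open import Function using (_∘_)
  open import Relation.Nullary using (yes; no)
  open import Relation.Binary.Definitions using (tri<; tri≈; tri>)
  open import Relation.Binary.PropositionalEquality hiding ([_])
  open import Data.List.Membership.DecPropositional _≟_ using (_∈?_)

  words-∈⁻ : ∀ k n {w} → w ∈ words k n → length w ≡ k × All (_< n) w
  words-∈⁻ zero    n (here refl) = refl , []
  words-∈⁻ (suc k) n w∈ with find (∈-concatMap⁻ (λ v → map (v ∷_) (words k n)) {xs = upTo n} w∈)
  ... | v , v∈ , w∈v with ∈-map⁻ (v ∷_) w∈v
  ... | u , u∈ , refl = let (len , bnd) = words-∈⁻ k n u∈ in cong suc len , ∈-upTo⁻ v∈ ∷ bnd

  words-∈⁺ : ∀ k n {w} → length w ≡ k → All (_< n) w → w ∈ words k n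
  words-∈⁺ zero    n {[]}    _   _           = here refl
  words-∈⁺ (suc k) n {v ∷ w} len (v<n ∷ w<n) =
    ∈-concatMap⁺ (λ v → map (v ∷_) (words k n))
      (lose (∈-upTo⁺ v<n) (∈-map⁺ (v ∷_) (words-∈⁺ k n (suc-injective len) w<n)))

  words-unique : ∀ k n → Unique (words k n)
  words-unique zero    n = [] ∷ []
  words-unique (suc k) n =
    concatMap-unique (λ v → map (v ∷_) (words k n)) (upTo⁺ n)
      (λ _ → map⁺ (proj₂ ∘ ∷-injective) (words-unique k n)) same-head
    where
    same-head : ∀ {x y z} → x ∈ upTo n → y ∈ upTo n →
                z ∈ map (x ∷_) (words k n) → z ∈ map (y ∷_) (words k n) → x ≡ y
    same-head {x} {y} _ _ p q with ∈-map⁻ (x ∷_) p | ∈-map⁻ (y ∷_) q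
    ... | _ , _ , refl | _ , _ , eq = ∷-injectiveˡ eq

  record Avoider (n : ℕ) (w : List ℕ) : Set where
    constructor avoider
    field
      length≡ : length w ≡ n
      bounded : All (_< n) w
      unique  : Unique w
      avoids  : contains132 w ≡ false

  -- The standard decomposition of a 132-avoider of {0,…,n} around its maximum n:
  -- the entries before n are α raised by i, the entries after n are β, where α
  -- avoids 132 on {0,…,n-i-1} and β avoids 132 on {0,…,i-1}.
  glue : ℕ → ℕ → List ℕ → List ℕ → List ℕ
  glue n i α β = map (i +_) α ++ n ∷ β

  glued : (ℕ → List (List ℕ)) → ℕ → ℕ → List (List ℕ)
  glued A n i = concatMap (λ β → map (λ α → glue n i α β) (A (n ∸ i))) (A i)

  -- An enumeration of the 132-avoiders of size n, correct when n ≤ f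
  -- (f is recursion fuel, so that sizes i and n-i are available).
  avoiders : ℕ → ℕ → List (List ℕ)
  avoiders zero    _       = [ [] ]
  avoiders (suc f) zero    = [ [] ]
  avoiders (suc f) (suc n) = concatMap (glued (avoiders f) n) (upTo (suc n))

  glued-∈⁻ : ∀ A n i {z} → z ∈ glued A n i →
             ∃₂ λ α β → α ∈ A (n ∸ i) × β ∈ A i × z ≡ glue n i α β
  glued-∈⁻ A n i z∈ with find (∈-concatMap⁻ (λ β → map (λ α → glue n i α β) (A (n ∸ i))) {xs = A i} z∈)
  ... | β , β∈ , z∈β with ∈-map⁻ (λ α → glue n i α β) z∈β
  ... | α , α∈ , z≡ = α , β , α∈ , β∈ , z≡

  avoiders-∈⁻ : ∀ f n {z} → z ∈ avoiders (suc f) (suc n) →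
                ∃ λ i → i ≤ n × z ∈ glued (avoiders f) n i
  avoiders-∈⁻ f n z∈ with find (∈-concatMap⁻ (glued (avoiders f) n) {xs = upTo (suc n)} z∈)
  ... | i , i∈ , z∈i = i , <⇒≤pred (∈-upTo⁻ i∈) , z∈i

  raise-bounded : ∀ {n i α} → i ≤ n → All (_< n ∸ i) α → All (λ a → i + a < n) α
  raise-bounded {n} {i} i≤n = All.map (λ {a} a< → subst (i + a <_) (m+[n∸m]≡n i≤n) (+-monoʳ-< i a<))

  glue-avoider : ∀ {n i α β} → i ≤ n → Avoider (n ∸ i) α → Avoider i β → Avoider (suc n) (glue n i α β)
  glue-avoider {n} {i} {α} {β} i≤n (avoider lα α< α! α-avoids) (avoider lβ β< β! β-avoids) =
    avoider len bnd uniq (contains132-glue (map (i +_) α) n β i left<n i≤left β< β<n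
                            (trans (contains132-shift i α) α-avoids) β-avoids)
    where
    left<n : All (_< n) (map (i +_) α)
    left<n = All.map⁺ (raise-bounded i≤n α<)
    i≤left : All (i ≤_) (map (i +_) α)
    i≤left = All.map⁺ (All.tabulate (λ {a} _ → m≤m+n i a))
    β<n : All (_< n) β
    β<n = All.map (λ b<i → <-≤-trans b<i i≤n) β<
    len : length (glue n i α β) ≡ suc n
    len = begin
      length (map (i +_) α ++ n ∷ β)      ≡⟨ length-++ (map (i +_) α) ⟩
      length (map (i +_) α) + suc (length β) ≡⟨ cong₂ (λ a b → a + suc b) (trans (length-map (i +_) α) lα) lβ ⟩
      (n ∸ i) + suc i                     ≡⟨ +-suc (n ∸ i) i ⟩
      suc ((n ∸ i) + i)                   ≡⟨ cong suc (m∸n+n≡m i≤n) ⟩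
      suc n                               ∎
      where open ≡-Reasoning
    bnd : All (_< suc n) (glue n i α β)
    bnd = All.++⁺ (All.map m<n⇒m<1+n left<n) (n<1+n n ∷ All.map m<n⇒m<1+n β<n)
    uniq : Unique (glue n i α β)
    uniq = ++⁺ (map⁺ (+-cancelˡ-≡ i _ _) α!) (All.map (λ b<n b≡n → <-irrefl (sym b≡n) b<n) β<n ∷ β!) disjoint
      where
      disjoint : ∀ {v} → v ∈ map (i +_) α × v ∈ n ∷ β → ⊥
      disjoint (v∈ , here refl) = <-irrefl refl (All.lookup left<n v∈)
      disjoint (v∈ , there v∈β) = <-irrefl refl (<-≤-trans (All.lookup β< v∈β) (All.lookup i≤left v∈))

  avoiders-sound : ∀ f n {w} → n ≤ f → w ∈ avoiders f n → Avoider n w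
  avoiders-sound zero    zero    _ (here refl) = avoider refl [] [] refl
  avoiders-sound (suc f) zero    _ (here refl) = avoider refl [] [] refl
  avoiders-sound (suc f) (suc n) (s≤s n≤f) w∈ with avoiders-∈⁻ f n w∈
  ... | i , i≤n , w∈i with glued-∈⁻ (avoiders f) n i w∈i
  ... | α , β , α∈ , β∈ , refl =
    glue-avoider i≤n (avoiders-sound f (n ∸ i) (≤-trans (m∸n≤m n i) n≤f) α∈)
                     (avoiders-sound f i (≤-trans i≤n n≤f) β∈)

  -- The maximum n occurs once, so it splits a word uniquely.
  split-at-max : ∀ n {xs ys xs' ys'} → All (_< n) xs → All (_< n) xs' →
                 xs ++ n ∷ ys ≡ xs' ++ n ∷ ys' → xs ≡ xs' × ys ≡ ys'
  split-at-max n {[]}     {xs' = []}      _            _              refl = refl , refl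
  split-at-max n {[]}     {xs' = x' ∷ _}  _            (x'<n ∷ _)     eq   = ⊥-elim (<-irrefl (sym (∷-injectiveˡ eq)) x'<n)
  split-at-max n {x ∷ _}  {xs' = []}      (x<n ∷ _)    _              eq   = ⊥-elim (<-irrefl (∷-injectiveˡ eq) x<n)
  split-at-max n {x ∷ xs} {xs' = x' ∷ xs'} (_ ∷ xs<n) (_ ∷ xs'<n) eq with ∷-injective eq
  ... | refl , eq' = let (left , right) = split-at-max n xs<n xs'<n eq' in cong (x ∷_) left , right

  avoiders-unique : ∀ f n → n ≤ f → Unique (avoiders f n)
  avoiders-unique zero    zero    _         = [] ∷ []
  avoiders-unique (suc f) zero    _         = [] ∷ []
  avoiders-unique (suc f) (suc n) (s≤s n≤f) =
    concatMap-unique (glued A n) (upTo⁺ (suc n)) (glued-unique ∘ index≤n) same-size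
    where
    A = avoiders f
    index≤n : ∀ {i} → i ∈ upTo (suc n) → i ≤ n
    index≤n = <⇒≤pred ∘ ∈-upTo⁻
    left<n : ∀ {i α} → i ≤ n → α ∈ A (n ∸ i) → All (_< n) (map (i +_) α)
    left<n {i} i≤n α∈ =
      All.map⁺ (raise-bounded i≤n (Avoider.bounded (avoiders-sound f (n ∸ i) (≤-trans (m∸n≤m n i) n≤f) α∈)))
    split : ∀ {i j α α' β β'} → i ≤ n → j ≤ n → α ∈ A (n ∸ i) → α' ∈ A (n ∸ j) →
            glue n i α β ≡ glue n j α' β' → map (i +_) α ≡ map (j +_) α' × β ≡ β'
    split i≤n j≤n α∈ α'∈ = split-at-max n (left<n i≤n α∈) (left<n j≤n α'∈)
    -- within a block, β and then α are recovered by splitting at n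
    glued-unique : ∀ {i} → i ≤ n → Unique (glued A n i)
    glued-unique {i} i≤n =
      concatMap-unique _ (avoiders-unique f i (≤-trans i≤n n≤f))
        (λ _ → map-unique-on _ (λ α∈ α'∈ eq → map-injective (+-cancelˡ-≡ i _ _) (proj₁ (split i≤n i≤n α∈ α'∈ eq)))
                               (avoiders-unique f (n ∸ i) (≤-trans (m∸n≤m n i) n≤f)))
        same-right
      where
      same-right : ∀ {β β' z} → β ∈ A i → β' ∈ A i →
                   z ∈ map (λ α → glue n i α β) (A (n ∸ i)) → z ∈ map (λ α → glue n i α β') (A (n ∸ i)) → β ≡ β'
      same-right {β} {β'} _ _ p q with ∈-map⁻ (λ α → glue n i α β) p | ∈-map⁻ (λ α → glue n i α β') q
      ... | α , α∈ , refl | α' , α'∈ , eq = proj₂ (split i≤n i≤n α∈ α'∈ eq)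
    -- different blocks are disjoint: i is recovered as the size of the right part
    same-size : ∀ {i j z} → i ∈ upTo (suc n) → j ∈ upTo (suc n) → z ∈ glued A n i → z ∈ glued A n j → i ≡ j
    same-size {i} {j} i∈ j∈ p q with glued-∈⁻ A n i p | glued-∈⁻ A n j q
    ... | α , β , α∈ , β∈ , refl | α' , β' , α'∈ , β'∈ , eq =
      trans (sym (Avoider.length≡ (avoiders-sound f i (≤-trans (index≤n i∈) n≤f) β∈)))
            (trans (cong length (proj₂ (split (index≤n i∈) (index≤n j∈) α∈ α'∈ eq)))
                   (Avoider.length≡ (avoiders-sound f j (≤-trans (index≤n j∈) n≤f) β'∈)))

  -- By pigeonhole, a permutation of {0,…,n} contains its maximum n.
  max-∈ : ∀ {n w} → Avoider (suc n) w → n ∈ w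
  max-∈ {n} {w} (avoider len bnd w! _) with n ∈? w
  ... | yes n∈w = n∈w
  ... | no  n∉w = ⊥-elim (1+n≰n (begin
    suc n             ≡⟨ len ⟨
    length w          ≤⟨ unique-⊆-length w! w⊆upTo ⟩
    length (upTo n)   ≡⟨ length-upTo n ⟩
    n                 ∎))
    where
    open ≤-Reasoning
    w⊆upTo : ∀ {z} → z ∈ w → z ∈ upTo n
    w⊆upTo {z} z∈w = ∈-upTo⁺ (≤∧≢⇒< (<⇒≤pred (All.lookup bnd z∈w)) (λ z≡n → n∉w (subst (_∈ w) z≡n z∈w)))

  between : ℕ → ℕ → List ℕ
  between y n = map (suc y +_) (upTo (n ∸ suc y))

  ∈-between : ∀ {y x n} → y < x → x < n → x ∈ between y n
  ∈-between {y} {x} {n} y<x x<n =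
    subst (_∈ between y n) (m+[n∸m]≡n y<x) (∈-map⁺ (suc y +_) (∈-upTo⁺ (∸-monoˡ-< x<n y<x)))

  length-between : ∀ y n → length (between y n) ≡ n ∸ suc y
  length-between y n = trans (length-map (suc y +_) (upTo (n ∸ suc y))) (length-upTo (n ∸ suc y))

  module Decomposition {n xs ys} (av : Avoider (suc n) (xs ++ n ∷ ys)) where
    open Avoider av

    private
      halves = unique-++⁻ xs unique
      bounds = All.++⁻ xs bounded

    left-unique : Unique xs
    left-unique = proj₁ halves

    right-unique : Unique ys
    right-unique with proj₁ (proj₂ halves)
    ... | _ ∷ ys! = ys!

    disjoint : ∀ {z} → z ∈ xs → z ∈ n ∷ ys → ⊥
    disjoint = proj₂ (proj₂ halves)

    left<n : All (_< n) xs
    left<n = All.tabulate λ x∈ →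
      ≤∧≢⇒< (<⇒≤pred (All.lookup (proj₁ bounds) x∈)) (λ x≡n → disjoint x∈ (here x≡n))

    right<n : All (_< n) ys
    right<n with proj₁ (proj₂ halves)
    ... | n∉ys ∷ _ = All.tabulate λ y∈ →
      ≤∧≢⇒< (<⇒≤pred (All.lookup (proj₂ bounds) (there y∈))) (λ y≡n → All.lookup n∉ys y∈ (sym y≡n))

    -- Avoiding 132 forces every entry left of n above every entry right of it.
    left-above-right : ∀ {x y} → x ∈ xs → y ∈ ys → y < x
    left-above-right {x} {y} x∈ y∈ with <-cmp x y
    ... | tri< x<y _ _ = ⊥-elim (both-ways (contains132-witness xs n ys x y x∈ y∈ x<y (All.lookup right<n y∈)) avoids)
    ... | tri≈ _ refl _ = ⊥-elim (disjoint x∈ (there y∈))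
    ... | tri> _ _ y<x  = y<x

    i : ℕ
    i = length ys

    sizes : length xs + i ≡ n
    sizes = suc-injective (begin
      suc (length xs + i)       ≡⟨ +-suc (length xs) i ⟨
      length xs + length (n ∷ ys) ≡⟨ length-++ xs ⟨
      length (xs ++ n ∷ ys)     ≡⟨ length≡ ⟩
      suc n                     ∎)
      where open ≡-Reasoning

    i≤n : i ≤ n
    i≤n = subst (i ≤_) sizes (m≤n+m i (length xs))

    -- ys lies below every left entry x, so by pigeonhole i ≤ x.
    i≤left : All (i ≤_) xs
    i≤left = All.tabulate λ {x} x∈ → subst (i ≤_) (length-upTo x)
      (unique-⊆-length right-unique (λ y∈ → ∈-upTo⁺ (left-above-right x∈ y∈)))

    -- xs lies strictly between y and n, so by pigeonhole n - i ≤ n - (y+1).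
    right<i : All (_< i) ys
    right<i = All.tabulate λ {y} y∈ → +-cancelˡ-≤ (n ∸ suc y) (suc y) i (begin
      n ∸ suc y + suc y ≡⟨ m∸n+n≡m (All.lookup right<n y∈) ⟩
      n                 ≡⟨ sizes ⟨
      length xs + i     ≤⟨ +-monoˡ-≤ i (subst (length xs ≤_) (length-between y n)
                             (unique-⊆-length left-unique (λ x∈ → ∈-between (left-above-right x∈ y∈) (All.lookup left<n x∈)))) ⟩
      n ∸ suc y + i     ∎)
      where open ≤-Reasoning

    -- Lowering the left part by i gives α, with glue n i α ys = xs ++ n ∷ ys;
    -- α and ys are avoiders because they sit inside one.
    α : List ℕ
    α = map (_∸ i) xs

    raise-α : map (i +_) α ≡ xs
    raise-α = lower-raise xs i≤left
      where
      lower-raise : ∀ zs → All (i ≤_) zs → map (i +_) (map (_∸ i) zs) ≡ zs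
      lower-raise []       []           = refl
      lower-raise (z ∷ zs) (i≤z ∷ i≤zs) = cong₂ _∷_ (m+[n∸m]≡n i≤z) (lower-raise zs i≤zs)

    left-avoider : Avoider (n ∸ i) α
    left-avoider = avoider
      (trans (length-map (_∸ i) xs) (trans (sym (m+n∸n≡m (length xs) i)) (cong (_∸ i) sizes)))
      (All.map⁺ (All.zipWith (λ (x<n , i≤x) → ∸-monoˡ-< x<n i≤x) (left<n , i≤left)))
      (map⁻ (subst Unique (sym raise-α) left-unique))
      (begin
        contains132 α                 ≡⟨ contains132-shift i α ⟨
        contains132 (map (i +_) α)    ≡⟨ cong contains132 raise-α ⟩
        contains132 xs                ≡⟨ contraposeᵇ (contains132-++ˡ xs (n ∷ ys)) avoids ⟩
        false                         ∎)
      where open ≡-Reasoning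

    right-avoider : Avoider i ys
    right-avoider = avoider refl right<i right-unique
      (contraposeᵇ (contains132-++ʳ xs (n ∷ ys) ∘ ∨-true-right _) avoids)

  avoiders-complete : ∀ f n {w} → n ≤ f → Avoider n w → w ∈ avoiders f n
  avoiders-complete zero    zero    {[]}    _ _ = here refl
  avoiders-complete (suc f) zero    {[]}    _ _ = here refl
  avoiders-complete _       zero    {_ ∷ _} _ (avoider () _ _ _)
  avoiders-complete (suc f) (suc n) (s≤s n≤f) av with ∈-∃++ (max-∈ av)
  ... | xs , ys , refl = subst (_∈ avoiders (suc f) (suc n)) (cong (_++ n ∷ ys) raise-α) listed
    where
    open Decomposition av
    listed : glue n i α ys ∈ avoiders (suc f) (suc n)
    listed = ∈-concatMap⁺ (glued (avoiders f) n) (lose (∈-upTo⁺ (s≤s i≤n))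
               (∈-concatMap⁺ (λ β → map (λ α → glue n i α β) (avoiders f (n ∸ i)))
                 (lose (avoiders-complete f i (≤-trans i≤n n≤f) right-avoider)
                   (∈-map⁺ (λ α → glue n i α ys) (avoiders-complete f (n ∸ i) (≤-trans (m∸n≤m n i) n≤f) left-avoider)))))

module NatSums where

  open ListCounting using (count; count-cong; count-none)
  open BooleanTests using (≡ᵇ-true; ≡ᵇ-false)
  open import Data.Bool using (true; false; if_then_else_)
  open import Data.Nat using (ℕ; zero; suc; _+_; _*_; _∸_; _≤_; _<_; z≤n; s≤s; _≡ᵇ_; _≤?_)
  open import Data.Nat.Properties
  open import Data.Nat.ListAction using (sum)
  open import Data.Nat.ListAction.Properties using (sum-++)
  open import Data.Nat.Solver using (module +-*-Solver)
  open import Data.List using (List; []; _∷_; _++_; [_]; map; upTo; length)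
  open import Data.List.Properties using (map-++; upTo-∷ʳ)
  open import Data.Sum using (inj₁; inj₂)
  open import Function using (_∘_)
  open import Relation.Nullary using (yes; no)
  open import Relation.Binary.PropositionalEquality hiding ([_])

  -- Σ_{i=0}^{n} g i over ℕ, recursing like Defs.sumTo so that the two agree.
  sumℕ : ℕ → (ℕ → ℕ) → ℕ
  sumℕ zero    g = g zero
  sumℕ (suc n) g = sumℕ n g + g (suc n)

  sumℕ-cong : ∀ n {g h : ℕ → ℕ} → (∀ i → i ≤ n → g i ≡ h i) → sumℕ n g ≡ sumℕ n h
  sumℕ-cong zero    g≡h = g≡h 0 z≤n
  sumℕ-cong (suc n) g≡h = cong₂ _+_ (sumℕ-cong n (λ i i≤n → g≡h i (m≤n⇒m≤1+n i≤n))) (g≡h (suc n) ≤-refl)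

  sumℕ-+ : ∀ n (g h : ℕ → ℕ) → sumℕ n (λ i → g i + h i) ≡ sumℕ n g + sumℕ n h
  sumℕ-+ zero    g h = refl
  sumℕ-+ (suc n) g h rewrite sumℕ-+ n g h =
    solve 4 (λ a b c d → (a :+ b) :+ (c :+ d) := (a :+ c) :+ (b :+ d)) refl (sumℕ n g) (sumℕ n h) (g (suc n)) (h (suc n))
    where open +-*-Solver

  sumℕ-zero : ∀ n {g : ℕ → ℕ} → (∀ i → i ≤ n → g i ≡ 0) → sumℕ n g ≡ 0
  sumℕ-zero n g≡0 = trans (sumℕ-cong n g≡0) (all-zero n)
    where
    all-zero : ∀ n → sumℕ n (λ _ → 0) ≡ 0
    all-zero zero    = refl
    all-zero (suc n) = cong (_+ 0) (all-zero n)

  sum-upTo : ∀ (g : ℕ → ℕ) n → sum (map g (upTo (suc n))) ≡ sumℕ n g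
  sum-upTo g zero    = +-identityʳ (g 0)
  sum-upTo g (suc n) = begin
    sum (map g (upTo (suc (suc n))))               ≡⟨ cong (sum ∘ map g) (upTo-∷ʳ (suc n)) ⟨
    sum (map g (upTo (suc n) ++ [ suc n ]))        ≡⟨ cong sum (map-++ g (upTo (suc n)) [ suc n ]) ⟩
    sum (map g (upTo (suc n)) ++ [ g (suc n) ])    ≡⟨ sum-++ (map g (upTo (suc n))) [ g (suc n) ] ⟩
    sum (map g (upTo (suc n))) + (g (suc n) + 0)   ≡⟨ cong₂ _+_ (sum-upTo g n) (+-identityʳ (g (suc n))) ⟩
    sumℕ n g + g (suc n)                           ∎
    where open ≡-Reasoning

  sum-const : ∀ {a} {A : Set a} K (xs : List A) → sum (map (λ _ → K) xs) ≡ length xs * K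
  sum-const K []       = refl
  sum-const K (x ∷ xs) = cong (K +_) (sum-const K xs)

  sumℕ-absent : ∀ m v (X : ℕ → ℕ) → m < v → sumℕ m (λ j → if v ≡ᵇ j then X j else 0) ≡ 0
  sumℕ-absent m v X m<v =
    sumℕ-zero m (λ j j≤m → cong (if_then X j else 0) (≡ᵇ-false (λ v≡j → <⇒≱ m<v (subst (_≤ m) (sym v≡j) j≤m))))

  sumℕ-pick : ∀ m v (X : ℕ → ℕ) → v ≤ m → sumℕ m (λ j → if v ≡ᵇ j then X j else 0) ≡ X v
  sumℕ-pick zero    zero X _ = refl
  sumℕ-pick (suc m) v    X v≤1+m with m≤n⇒m<n∨m≡n v≤1+m
  ... | inj₁ v<1+m = begin
    sumℕ m (λ j → if v ≡ᵇ j then X j else 0) + (if v ≡ᵇ suc m then X (suc m) else 0)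
      ≡⟨ cong₂ _+_ (sumℕ-pick m v X (<⇒≤pred v<1+m)) (cong (if_then X (suc m) else 0) (≡ᵇ-false (<⇒≢ v<1+m))) ⟩
    X v + 0 ≡⟨ +-identityʳ (X v) ⟩
    X v     ∎
    where open ≡-Reasoning
  ... | inj₂ refl = begin
    sumℕ m (λ j → if suc m ≡ᵇ j then X j else 0) + (if suc m ≡ᵇ suc m then X (suc m) else 0)
      ≡⟨ cong₂ _+_ (sumℕ-absent m (suc m) X (n<1+n m)) (cong (if_then X (suc m) else 0) (≡ᵇ-true {suc m} refl)) ⟩
    X (suc m) ∎
    where open ≡-Reasoning

  +-≡ᵇ : ∀ x {v m} → v ≤ m → (x + v ≡ᵇ m) ≡ (x ≡ᵇ m ∸ v)
  +-≡ᵇ x {zero}          _         = cong (_≡ᵇ _) (+-identityʳ x)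
  +-≡ᵇ x {suc v} {suc m} (s≤s v≤m) = trans (cong (_≡ᵇ suc m) (+-suc x v)) (+-≡ᵇ x v≤m)

  +-≡ᵇ-over : ∀ x {v m} → m < v → (x + v ≡ᵇ m) ≡ false
  +-≡ᵇ-over x {v} m<v = ≡ᵇ-false (λ x+v≡m → <⇒≱ m<v (subst (v ≤_) x+v≡m (m≤n+m v x)))

  count-convolution : ∀ {a b} {A : Set a} {B : Set b} (f : A → ℕ) (g : B → ℕ) (As : List A) m Bs →
    sum (map (λ β → count (λ α → f α + g β ≡ᵇ m) As) Bs)
      ≡ sumℕ m (λ j → count (λ β → g β ≡ᵇ j) Bs * count (λ α → f α ≡ᵇ m ∸ j) As)
  count-convolution f g As m []       = sym (sumℕ-zero m (λ _ _ → refl))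
  count-convolution f g As m (β ∷ Bs) = begin
    count (λ α → f α + g β ≡ᵇ m) As + sum (map (λ β → count (λ α → f α + g β ≡ᵇ m) As) Bs)
      ≡⟨ cong₂ _+_ first-term (count-convolution f g As m Bs) ⟩
    sumℕ m (λ j → if g β ≡ᵇ j then X j else 0) + sumℕ m (λ j → count (λ β → g β ≡ᵇ j) Bs * X j)
      ≡⟨ sumℕ-+ m _ _ ⟨
    sumℕ m (λ j → (if g β ≡ᵇ j then X j else 0) + count (λ β → g β ≡ᵇ j) Bs * X j)
      ≡⟨ sumℕ-cong m (λ j _ → count-cons j) ⟩
    sumℕ m (λ j → count (λ β → g β ≡ᵇ j) (β ∷ Bs) * X j) ∎
    where
    open ≡-Reasoning
    X : ℕ → ℕ
    X j = count (λ α → f α ≡ᵇ m ∸ j) As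
    -- the count for β is the single term j = g β of the indicator sum (or 0 if g β > m)
    first-term : count (λ α → f α + g β ≡ᵇ m) As ≡ sumℕ m (λ j → if g β ≡ᵇ j then X j else 0)
    first-term with g β ≤? m
    ... | yes gβ≤m = trans (count-cong _ _ As (λ {α} _ → +-≡ᵇ (f α) gβ≤m)) (sym (sumℕ-pick m (g β) X gβ≤m))
    ... | no  gβ≰m = trans (count-none _ As (λ {α} _ → +-≡ᵇ-over (f α) (≰⇒> gβ≰m))) (sym (sumℕ-absent m (g β) X (≰⇒> gβ≰m)))
    count-cons : ∀ j → (if g β ≡ᵇ j then X j else 0) + count (λ β → g β ≡ᵇ j) Bs * X j
                       ≡ count (λ β → g β ≡ᵇ j) (β ∷ Bs) * X j
    count-cons j with g β ≡ᵇ j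
    ... | true  = refl
    ... | false = refl

module Statistic where

  open BooleanTests using (<ᵇ-true; <ᵇ-false)
  open Pattern132 using (+-<ᵇ)
  open Enumeration using (glue)
  open import Data.Bool using (true; false; _∧_; if_then_else_)
  open import Data.Bool.Properties using (∧-identityʳ)
  open import Data.Nat using (ℕ; zero; suc; _+_; _≤_; _<_; _≤ᵇ_; _<ᵇ_)
  open import Data.Nat.Properties using (+-comm; +-assoc; <⇒≤; <-≤-trans; m≤m+n)
  open import Data.List using (List; []; _∷_; _++_; map; length)
  open import Data.List.Relation.Unary.All as All using (All; []; _∷_)
  open import Relation.Binary.PropositionalEquality using (_≡_; refl; sym; cong; cong₂)

  mmpRight : ℕ → List ℕ → ℕ
  mmpRight k []         = 0
  mmpRight k (v ∷ post) = (if k ≤ᵇ countB (v <ᵇ_) post then 1 else 0) + mmpRight k post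

  -- With b = c = d = 0 only the first condition of MMP(a,b,c,d) constrains a position.
  mmp-right : ∀ k pre w → mmpGo k 0 0 0 pre w ≡ mmpRight k w
  mmp-right k pre []         = refl
  mmp-right k pre (v ∷ post) =
    cong₂ (λ b r → (if b then 1 else 0) + r) (∧-identityʳ (k ≤ᵇ countB (v <ᵇ_) post)) (mmp-right k (v ∷ pre) post)

  mmpRight-zero : ∀ w → mmpRight 0 w ≡ length w
  mmpRight-zero []      = refl
  mmpRight-zero (v ∷ w) = cong suc (mmpRight-zero w)

  countB-++ : ∀ p xs ys → countB p (xs ++ ys) ≡ countB p xs + countB p ys
  countB-++ p []       ys = refl
  countB-++ p (x ∷ xs) ys with p x
  ... | true  = cong suc (countB-++ p xs ys)
  ... | false = countB-++ p xs ys

  countB-none : ∀ p {xs} → All (λ x → p x ≡ false) xs → countB p xs ≡ 0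
  countB-none p []              = refl
  countB-none p (px≡false ∷ ps) rewrite px≡false = countB-none p ps

  countB-raise : ∀ i x zs → countB ((i + x) <ᵇ_) (map (i +_) zs) ≡ countB (x <ᵇ_) zs
  countB-raise i x []       = refl
  countB-raise i x (z ∷ zs) rewrite +-<ᵇ i x z | countB-raise i x zs = refl

  ≤ᵇ-suc : ∀ k c → (suc k ≤ᵇ suc c) ≡ (k ≤ᵇ c)
  ≤ᵇ-suc zero    c = refl
  ≤ᵇ-suc (suc k) c = refl

  -- In glue n i α β each entry of α gains exactly one larger entry to its right
  -- (the maximum n), and β is unaffected; hence the statistic splits additively.
  mmpRight-glue : ∀ k n i α β → All (λ a → i + a < n) α → All (_< i) β → All (_< n) β →
                  mmpRight (suc k) (glue n i α β) ≡ mmpRight k α + mmpRight (suc k) β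
  mmpRight-glue k n i []      β _ _ β<n
    rewrite countB-none (n <ᵇ_) (All.map (λ b<n → <ᵇ-false (<⇒≤ b<n)) β<n) = refl
  mmpRight-glue k n i (a ∷ α) β (a<n ∷ α<n) β<i β<n
    rewrite countB-++ ((i + a) <ᵇ_) (map (i +_) α) (n ∷ β) | countB-raise i a α | <ᵇ-true a<n
          | countB-none ((i + a) <ᵇ_) (All.map (λ b<i → <ᵇ-false (<⇒≤ (<-≤-trans b<i (m≤m+n i a)))) β<i)
          | +-comm (countB (a <ᵇ_) α) 1 | ≤ᵇ-suc k (countB (a <ᵇ_) α)
          | mmpRight-glue k n i α β α<n β<i β<n
    = sym (+-assoc (if k ≤ᵇ countB (a <ᵇ_) α then 1 else 0) (mmpRight k α) _)

module Coefficients where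

  open ListCounting
  open NatSums
  open Statistic
  open BooleanTests
  open Pattern132
  open Enumeration
  open import Data.Bool using (Bool; true; false; T; _∧_; not; if_then_else_)
  open import Data.Bool.Properties using (T-≡; not-injective)
  open import Data.Nat using (ℕ; suc; _+_; _*_; _∸_; _≤_; _<_; _≡ᵇ_)
  open import Data.Nat.Properties
  open import Data.Nat.ListAction using (sum)
  open import Data.List using (List; []; _∷_; [_]; map; upTo; length; concatMap)
  open import Data.List.Properties using (map-cong; map-cong-local)
  open import Data.List.Membership.Propositional using (_∈_)
  open import Data.List.Relation.Unary.All as All using (All; []; _∷_)
  open import Data.List.Relation.Unary.AllPairs using ([]; _∷_)
  open import Data.List.Relation.Unary.Unique.Propositional using (Unique)
  open import Data.Product using (_×_; _,_; proj₁; proj₂)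
  open import Function using (_∘_)
  open import Function.Bundles using (Equivalence)
  open import Relation.Binary.PropositionalEquality hiding ([_])

  distinct⇒unique : ∀ w → distinct w ≡ true → Unique w
  distinct⇒unique []       _  = []
  distinct⇒unique (x ∷ xs) ok with ∧-true {not (anyB (x ≡ᵇ_) xs)} ok
  ... | fresh , rest =
    All.map (λ x≡ᵇy x≡y → both-ways (≡ᵇ-true x≡y) x≡ᵇy) (anyB-none⁻ (x ≡ᵇ_) xs (not-injective {y = false} fresh))
    ∷ distinct⇒unique xs rest

  unique⇒distinct : ∀ {w} → Unique w → distinct w ≡ true
  unique⇒distinct {[]}     []           = refl
  unique⇒distinct {x ∷ xs} (x∉xs ∷ xs!) =
    cong₂ (λ a b → not a ∧ b) (anyB-none (x ≡ᵇ_) (All.map ≡ᵇ-false x∉xs)) (unique⇒distinct xs!)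

  avoider⇒tests : ∀ {n w} → Avoider n w → isPerm n w ≡ true × avoids132 w ≡ true
  avoider⇒tests (avoider len _ w! avoids) =
    cong₂ _∧_ (≡ᵇ-true len) (unique⇒distinct w!) , cong not avoids

  tests⇒avoider : ∀ {n w} → All (_< n) w → isPerm n w ≡ true → avoids132 w ≡ true → Avoider n w
  tests⇒avoider {n} {w} bnd perm avoids with ∧-true {length w ≡ᵇ n} perm
  ... | len , dist = avoider (≡ᵇ⇒≡ (length w) n (Equivalence.from T-≡ len)) bnd
                             (distinct⇒unique w dist) (not-injective {y = false} avoids)

  countQ-count : ∀ a b c d ws n m →
                 countQ a b c d ws n m ≡ count (λ w → isPerm n w ∧ avoids132 w ∧ (mmp a b c d w ≡ᵇ m)) ws
  countQ-count a b c d []       n m = refl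
  countQ-count a b c d (w ∷ ws) n m with isPerm n w ∧ avoids132 w ∧ (mmp a b c d w ≡ᵇ m)
  ... | true  = cong suc (countQ-count a b c d ws n m)
  ... | false = countQ-count a b c d ws n m

  coeff : ℕ → ℕ → ℕ → ℕ
  coeff k n m = Qcoeff k 0 0 0 n m

  -- It counts the avoiders of size n (listed with any sufficient fuel) on which
  -- mmp^{(k,0,0,0)} equals m: the words passing Qcoeff's test are exactly the
  -- listed avoiders with that statistic, and both lists are repetition-free.
  coeff-avoiders : ∀ k f n m → n ≤ f → coeff k n m ≡ count (λ w → mmpRight k w ≡ᵇ m) (avoiders f n)
  coeff-avoiders k f n m n≤f = begin
    coeff k n m                                    ≡⟨ countQ-count k 0 0 0 (words n n) n m ⟩
    count test (words n n)                         ≡⟨ count-unique-≡ test (words-unique n n) (avoiders-unique f n n≤f)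
                                                        word⇒listed listed⇒word ⟩
    count test (avoiders f n)                      ≡⟨ count-cong _ _ (avoiders f n) test-on-avoiders ⟩
    count (λ w → mmpRight k w ≡ᵇ m) (avoiders f n) ∎
    where
    open ≡-Reasoning
    test : List ℕ → Bool
    test w = isPerm n w ∧ avoids132 w ∧ (mmp k 0 0 0 w ≡ᵇ m)
    word⇒listed : ∀ {z} → T (test z) → z ∈ words n n → z ∈ avoiders f n
    word⇒listed {z} t z∈ with ∧-true {isPerm n z} (Equivalence.to T-≡ t)
    ... | perm , rest = avoiders-complete f n n≤f
                          (tests⇒avoider (proj₂ (words-∈⁻ n n z∈)) perm (proj₁ (∧-true {avoids132 z} rest)))
    listed⇒word : ∀ {z} → T (test z) → z ∈ avoiders f n → z ∈ words n n
    listed⇒word _ z∈ = let av = avoiders-sound f n n≤f z∈ in words-∈⁺ n n (Avoider.length≡ av) (Avoider.bounded av)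
    test-on-avoiders : ∀ {z} → z ∈ avoiders f n → test z ≡ (mmpRight k z ≡ᵇ m)
    test-on-avoiders {z} z∈ with avoider⇒tests (avoiders-sound f n n≤f z∈)
    ... | perm , avoids = trans (cong₂ (λ a b → a ∧ b ∧ (mmp k 0 0 0 z ≡ᵇ m)) perm avoids)
                                (cong (_≡ᵇ m) (mmp-right k [] z))

  count-avoiders-suc : ∀ p f n → count p (avoiders (suc f) (suc n)) ≡
    sumℕ n (λ i → sum (map (λ β → count (λ α → p (glue n i α β)) (avoiders f (n ∸ i))) (avoiders f i)))
  count-avoiders-suc p f n = begin
    count p (concatMap (glued A n) (upTo (suc n)))   ≡⟨ count-concatMap p (glued A n) (upTo (suc n)) ⟩
    sum (map (count p ∘ glued A n) (upTo (suc n)))   ≡⟨ sum-upTo (count p ∘ glued A n) n ⟩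
    sumℕ n (count p ∘ glued A n)                     ≡⟨ sumℕ-cong n (λ i _ → block i) ⟩
    sumℕ n (λ i → sum (map (λ β → count (λ α → p (glue n i α β)) (A (n ∸ i))) (A i))) ∎
    where
    open ≡-Reasoning
    A = avoiders f
    block : ∀ i → count p (glued A n i) ≡ sum (map (λ β → count (λ α → p (glue n i α β)) (A (n ∸ i))) (A i))
    block i = trans (count-concatMap p _ (A i))
                    (cong sum (map-cong (λ β → count-map p (λ α → glue n i α β) (A (n ∸ i))) (A i)))

  -- The coefficient recurrence behind Q_{k+1} = 1 + t·Q_{k+1}·Q_k: the right part
  -- β keeps its statistic, the left part α has its statistic lowered by one level.
  coeff-recurrence : ∀ k n m →
    coeff (suc k) (suc n) m ≡ sumℕ n (λ i → sumℕ m (λ j → coeff (suc k) i j * coeff k (n ∸ i) (m ∸ j)))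
  coeff-recurrence k n m = begin
    coeff (suc k) (suc n) m
      ≡⟨ coeff-avoiders (suc k) (suc n) (suc n) m ≤-refl ⟩
    count (λ w → mmpRight (suc k) w ≡ᵇ m) (avoiders (suc n) (suc n))
      ≡⟨ count-avoiders-suc _ n n ⟩
    sumℕ n (λ i → sum (map (λ β → count (λ α → mmpRight (suc k) (glue n i α β) ≡ᵇ m) (A (n ∸ i))) (A i)))
      ≡⟨ sumℕ-cong n fixed-split ⟩
    sumℕ n (λ i → sumℕ m (λ j → coeff (suc k) i j * coeff k (n ∸ i) (m ∸ j))) ∎
    where
    open ≡-Reasoning
    A = avoiders n
    fixed-split : ∀ i → i ≤ n → sum (map (λ β → count (λ α → mmpRight (suc k) (glue n i α β) ≡ᵇ m) (A (n ∸ i))) (A i))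
                           ≡ sumℕ m (λ j → coeff (suc k) i j * coeff k (n ∸ i) (m ∸ j))
    fixed-split i i≤n = begin
      sum (map (λ β → count (λ α → mmpRight (suc k) (glue n i α β) ≡ᵇ m) (A (n ∸ i))) (A i))
        ≡⟨ cong sum (map-cong-local (All.tabulate λ β∈ → count-cong _ _ (A (n ∸ i)) λ α∈ →
             cong (_≡ᵇ m) (split-statistic α∈ β∈))) ⟩
      sum (map (λ β → count (λ α → mmpRight k α + mmpRight (suc k) β ≡ᵇ m) (A (n ∸ i))) (A i))
        ≡⟨ count-convolution (mmpRight k) (mmpRight (suc k)) (A (n ∸ i)) m (A i) ⟩
      sumℕ m (λ j → count (λ β → mmpRight (suc k) β ≡ᵇ j) (A i) * count (λ α → mmpRight k α ≡ᵇ m ∸ j) (A (n ∸ i)))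
        ≡⟨ sumℕ-cong m (λ j _ → cong₂ _*_ (sym (coeff-avoiders (suc k) n i j i≤n))
                                            (sym (coeff-avoiders k n (n ∸ i) (m ∸ j) (m∸n≤m n i)))) ⟩
      sumℕ m (λ j → coeff (suc k) i j * coeff k (n ∸ i) (m ∸ j)) ∎
      where
      split-statistic : ∀ {α β} → α ∈ A (n ∸ i) → β ∈ A i →
                        mmpRight (suc k) (glue n i α β) ≡ mmpRight k α + mmpRight (suc k) β
      split-statistic {α} {β} α∈ β∈ =
        mmpRight-glue k n i α β (raise-bounded i≤n (Avoider.bounded (avoiders-sound n (n ∸ i) (m∸n≤m n i) α∈)))
                      β<i (All.map (λ b<i → <-≤-trans b<i i≤n) β<i)
        where β<i = Avoider.bounded (avoiders-sound n i i≤n β∈)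

  -- The number of 132-avoiding permutations of size n (the diagonal coefficient of
  -- Q^{(0,0,0,0)}, since mmp^{(0,0,0,0)} is the size); it is the length of the list.
  size : ℕ → ℕ
  size n = coeff 0 n n

  size-avoiders : ∀ f n → n ≤ f → size n ≡ length (avoiders f n)
  size-avoiders f n n≤f = begin
    size n                                        ≡⟨ coeff-avoiders 0 f n n n≤f ⟩
    count (λ w → mmpRight 0 w ≡ᵇ n) (avoiders f n) ≡⟨ count-cong _ _ (avoiders f n) all-pass ⟩
    count (λ _ → true) (avoiders f n)             ≡⟨ count-const-true (avoiders f n) ⟩
    length (avoiders f n)                         ∎
    where
    open ≡-Reasoning
    all-pass : ∀ {z} → z ∈ avoiders f n → (mmpRight 0 z ≡ᵇ n) ≡ true
    all-pass {z} z∈ = ≡ᵇ-true (trans (mmpRight-zero z) (Avoider.length≡ (avoiders-sound f n n≤f z∈)))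

  -- For k = 0 the statistic is the size, so Q^{(0,0,0,0)} lives on the diagonal.
  coeff-zero : ∀ n m → coeff 0 n m ≡ (if n ≡ᵇ m then size n else 0)
  coeff-zero n m with n ≡ᵇ m in n≡ᵇm
  ... | true  rewrite ≡ᵇ⇒≡ n m (Equivalence.from T-≡ n≡ᵇm) = refl
  ... | false = trans (coeff-avoiders 0 n n m ≤-refl) (count-none _ (avoiders n n) size-n≠m)
    where
    size-n≠m : ∀ {z} → z ∈ avoiders n n → (mmpRight 0 z ≡ᵇ m) ≡ false
    size-n≠m {z} z∈ = trans (cong (_≡ᵇ m) (trans (mmpRight-zero z) (Avoider.length≡ (avoiders-sound n n ≤-refl z∈)))) n≡ᵇm

  size-recurrence : ∀ n → size (suc n) ≡ sumℕ n (λ i → size i * size (n ∸ i))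
  size-recurrence n = begin
    size (suc n)                                        ≡⟨ size-avoiders (suc n) (suc n) ≤-refl ⟩
    length (avoiders (suc n) (suc n))                   ≡⟨ count-const-true (avoiders (suc n) (suc n)) ⟨
    count (λ _ → true) (avoiders (suc n) (suc n))       ≡⟨ count-avoiders-suc _ n n ⟩
    sumℕ n (λ i → sum (map (λ _ → count (λ _ → true) (A (n ∸ i))) (A i))) ≡⟨ sumℕ-cong n product ⟩
    sumℕ n (λ i → size i * size (n ∸ i))                ∎
    where
    open ≡-Reasoning
    A = avoiders n
    product : ∀ i → i ≤ n → sum (map (λ _ → count (λ _ → true) (A (n ∸ i))) (A i)) ≡ size i * size (n ∸ i)
    product i i≤n = trans (sum-const (count (λ _ → true) (A (n ∸ i))) (A i))
      (sym (cong₂ _*_ (size-avoiders n i i≤n)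
                      (trans (size-avoiders n (n ∸ i) (m∸n≤m n i)) (sym (count-const-true (A (n ∸ i)))))))

module CentralBinomial where

  open import Data.Nat using (ℕ; suc; _+_; _*_; _∸_; _≤_; s≤s; _!)
  open import Data.Nat.Properties
  open import Data.Nat.Combinatorics using (_C_; nCk≡nC[n∸k]; k![n∸k]!∣n!)
  open import Data.Nat.Combinatorics.Specification using (nCk≡n!/k![n-k]!)
  open import Data.Nat.DivMod using (m/n*n≡m)
  open import Data.Nat.Solver using (module +-*-Solver)
  open import Relation.Binary.PropositionalEquality
  open +-*-Solver

  absorption : ∀ n k → k ≤ n → suc k * (suc n C suc k) ≡ suc n * (n C k)
  absorption n k k≤n = *-cancelʳ-≡ _ _ d {{k !* (n ∸ k) !≢0}} (begin
    suc k * X * d                      ≡⟨ solve 3 (λ a x e → (a :* x) :* e := x :* (a :* e)) refl (suc k) X d ⟩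
    X * (suc k * d)                    ≡⟨ cong (X *_) (*-assoc (suc k) (k !) ((n ∸ k) !)) ⟨
    X * (suc k ! * (n ∸ k) !)          ≡⟨ C-times-factorials (s≤s k≤n) ⟩
    suc n !                            ≡⟨ cong (suc n *_) (C-times-factorials k≤n) ⟨
    suc n * (Y * d)                    ≡⟨ *-assoc (suc n) Y d ⟨
    suc n * Y * d                      ∎)
    where
    open ≡-Reasoning
    X = suc n C suc k
    Y = n C k
    d = k ! * (n ∸ k) !
    C-times-factorials : ∀ {m j} → j ≤ m → (m C j) * (j ! * (m ∸ j) !) ≡ m !
    C-times-factorials {m} {j} j≤m =
      trans (cong (_* (j ! * (m ∸ j) !)) (nCk≡n!/k![n-k]! j≤m)) (m/n*n≡m {{j !* (m ∸ j) !≢0}} (k![n∸k]!∣n! j≤m))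

  centralBinomial : ℕ → ℕ
  centralBinomial n = (2 * n) C n

  -- Its recurrence (i+1)·C(2i+2, i+1) = 2(2i+1)·C(2i, i), by absorbing twice
  -- and using the symmetry C(2i+1, i+1) = C(2i+1, i).
  centralBinomial-step : ∀ i → suc i * centralBinomial (suc i) ≡ 2 * suc (2 * i) * centralBinomial i
  centralBinomial-step i = *-cancelˡ-≡ _ _ (suc i) (begin
    suc i * (suc i * (2 * suc i C suc i))          ≡⟨ cong (λ z → suc i * (suc i * (z C suc i))) two-suc ⟩
    suc i * (suc i * (suc (suc (2 * i)) C suc i))  ≡⟨ cong (suc i *_) (absorption (suc (2 * i)) i i≤1+2i) ⟩
    suc i * (suc (suc (2 * i)) * A)                ≡⟨ solve 3 (λ a b x → a :* (b :* x) := b :* (a :* x)) refl (suc i) (suc (suc (2 * i))) A ⟩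
    suc (suc (2 * i)) * (suc i * A)                ≡⟨ cong (λ z → suc (suc (2 * i)) * (suc i * z)) symmetry ⟨
    suc (suc (2 * i)) * (suc i * (suc (2 * i) C suc i)) ≡⟨ cong (suc (suc (2 * i)) *_) (absorption (2 * i) i i≤2i) ⟩
    suc (suc (2 * i)) * (suc (2 * i) * centralBinomial i)
      ≡⟨ solve 2 (λ i b → (con 2 :+ con 2 :* i) :* ((con 1 :+ con 2 :* i) :* b) := (con 1 :+ i) :* (con 2 :* (con 1 :+ con 2 :* i) :* b)) refl i (centralBinomial i) ⟩
    suc i * (2 * suc (2 * i) * centralBinomial i)  ∎)
    where
    open ≡-Reasoning
    A = suc (2 * i) C i
    two-suc : 2 * suc i ≡ suc (suc (2 * i))
    two-suc = solve 1 (λ i → con 2 :* (con 1 :+ i) := con 2 :+ con 2 :* i) refl i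
    i≤2i : i ≤ 2 * i
    i≤2i = m≤m+n i (i + 0)
    i≤1+2i : i ≤ suc (2 * i)
    i≤1+2i = m≤n⇒m≤1+n i≤2i
    symmetry : suc (2 * i) C suc i ≡ A
    symmetry = trans (nCk≡nC[n∸k] (s≤s i≤2i)) (cong (suc (2 * i) C_) (trans (m+n∸m≡n i (i + 0)) (+-identityʳ i)))

module IntegerSums where

  open NatSums using (sumℕ)
  open import Data.Nat as ℕ using (ℕ; zero; suc; _≤_; z≤n; s≤s)
  import Data.Nat.Properties as ℕ
  open import Data.Integer using (ℤ; +_; _+_; _*_; _-_)
  open import Data.Integer.Properties using (pos-+; +-identityˡ; +-identityʳ)
  open import Data.Integer.Solver using (module +-*-Solver)
  open import Data.Sum using (inj₁; inj₂)
  open import Relation.Binary.PropositionalEquality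
  open +-*-Solver

  sumTo-cong : ∀ n {f g : ℕ → ℤ} → (∀ i → i ≤ n → f i ≡ g i) → sumTo n f ≡ sumTo n g
  sumTo-cong zero    f≡g = f≡g 0 z≤n
  sumTo-cong (suc n) f≡g = cong₂ _+_ (sumTo-cong n (λ i i≤n → f≡g i (ℕ.m≤n⇒m≤1+n i≤n))) (f≡g (suc n) ℕ.≤-refl)

  sumTo-zero : ∀ n {g : ℕ → ℤ} → (∀ i → i ≤ n → g i ≡ + 0) → sumTo n g ≡ + 0
  sumTo-zero zero    g≡0 = g≡0 0 z≤n
  sumTo-zero (suc n) g≡0 = cong₂ _+_ (sumTo-zero n (λ i i≤n → g≡0 i (ℕ.m≤n⇒m≤1+n i≤n))) (g≡0 (suc n) ℕ.≤-refl)

  sumTo-single : ∀ n k {g : ℕ → ℤ} → k ≤ n → (∀ i → i ≤ n → i ≢ k → g i ≡ + 0) → sumTo n g ≡ g k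
  sumTo-single zero    zero    _   _   = refl
  sumTo-single (suc n) k {g} k≤1+n g≡0 with ℕ.m≤n⇒m<n∨m≡n k≤1+n
  ... | inj₁ k<1+n = begin
    sumTo n g + g (suc n) ≡⟨ cong₂ _+_ (sumTo-single n k (ℕ.<⇒≤pred k<1+n) (λ i i≤n → g≡0 i (ℕ.m≤n⇒m≤1+n i≤n)))
                                        (g≡0 (suc n) ℕ.≤-refl (λ 1+n≡k → ℕ.<⇒≢ k<1+n (sym 1+n≡k))) ⟩
    g k + + 0             ≡⟨ +-identityʳ (g k) ⟩
    g k                   ∎
    where open ≡-Reasoning
  ... | inj₂ refl = trans (cong (_+ g (suc n))
    (sumTo-zero n (λ i i≤n → g≡0 i (ℕ.m≤n⇒m≤1+n i≤n) (λ i≡1+n → ℕ.<⇒≢ (s≤s i≤n) i≡1+n)))) (+-identityˡ (g (suc n)))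

  sumTo-scale : ∀ n K (f : ℕ → ℤ) → sumTo n (λ i → K * f i) ≡ K * sumTo n f
  sumTo-scale zero    K f = refl
  sumTo-scale (suc n) K f rewrite sumTo-scale n K f =
    solve 3 (λ K a b → K :* a :+ K :* b := K :* (a :+ b)) refl K (sumTo n f) (f (suc n))

  sumTo-sub : ∀ n (f g : ℕ → ℤ) → sumTo n (λ i → f i - g i) ≡ sumTo n f - sumTo n g
  sumTo-sub zero    f g = refl
  sumTo-sub (suc n) f g rewrite sumTo-sub n f g =
    solve 4 (λ a b c d → a :- b :+ (c :- d) := a :+ c :- (b :+ d)) refl (sumTo n f) (sumTo n g) (f (suc n)) (g (suc n))

  telescope : ∀ n (G : ℕ → ℤ) → sumTo n (λ i → G (suc i) - G i) ≡ G (suc n) - G 0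
  telescope zero    G = refl
  telescope (suc n) G rewrite telescope n G =
    solve 3 (λ a b c → (b :- a) :+ (c :- b) := c :- a) refl (G 0) (G (suc n)) (G (suc (suc n)))

  sumℕ-sumTo : ∀ n (g : ℕ → ℕ) → + sumℕ n g ≡ sumTo n (λ i → + g i)
  sumℕ-sumTo zero    g = refl
  sumℕ-sumTo (suc n) g = trans (pos-+ (sumℕ n g) (g (suc n))) (cong (_+ + g (suc n)) (sumℕ-sumTo n g))

module CatalanClosedForm where

  open NatSums using (sumℕ)
  open CentralBinomial
  open IntegerSums
  open import Data.Nat as ℕ using (ℕ; zero; suc; _∸_; _≤_; z≤n; s≤s)
  import Data.Nat.Properties as ℕ
  open import Data.Nat.DivMod using (m*n/n≡m)
  open import Data.Integer using (ℤ; +_; _+_; _*_; _-_; NonZero)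
  open import Data.Integer.Properties using (pos-+; pos-*; +-injective; *-cancelˡ-≡)
  open import Data.Integer.Solver using (module +-*-Solver)
  open import Data.Sum using (inj₁; inj₂)
  open import Relation.Binary.PropositionalEquality
  open +-*-Solver

  -- The per-term identity behind the telescoping proof of the closed form.
  -- With P = i+1, R = r+1, N = i+r+1, I = i, b = c·(index+1), and b' obeying
  -- the central binomial recurrence P·b' + 2b = 4P·b:
  --   2N(N+1)·cᵢ·cᵣ = b'ᵢ·bᵣ·(2P - N) - bᵢ·b'ᵣ·(2I - N).
  -- It is a polynomial identity once multiplied by P·R.
  telescoping-term : ∀ P R N I ci cr bi br bi' br' → .{{_ : NonZero P}} → .{{_ : NonZero R}} →
    N ≡ P + R - + 1 → I ≡ P - + 1 → bi ≡ ci * P → br ≡ cr * R →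
    P * bi' + + 2 * bi ≡ + 4 * P * bi → R * br' + + 2 * br ≡ + 4 * R * br →
    + 2 * N * (+ 1 + N) * (ci * cr) ≡ bi' * br * (+ 2 * P - N) - bi * br' * (+ 2 * I - N)
  telescoping-term P R ._ ._ ci cr ._ ._ bi' br' refl refl refl refl hi hr =
    *-cancelˡ-≡ R _ _ (*-cancelˡ-≡ P _ _ (begin
      P * (R * (+ 2 * N * (+ 1 + N) * (ci * cr)))
        ≡⟨ solve 4 (λ P R ci cr →
             P :* (R :* (con (+ 2) :* (P :+ R :- con (+ 1)) :* (con (+ 1) :+ (P :+ R :- con (+ 1))) :* (ci :* cr)))
             := R :* (con (+ 4) :* P :* (ci :* P) :- con (+ 2) :* (ci :* P)) :* (cr :* R) :* (P :- R :+ con (+ 1))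
                :- P :* (con (+ 4) :* R :* (cr :* R) :- con (+ 2) :* (cr :* R)) :* (ci :* P) :* (P :- R :- con (+ 1)))
             refl P R ci cr ⟩
      R * (+ 4 * P * (ci * P) - + 2 * (ci * P)) * (cr * R) * (P - R + + 1)
        - P * (+ 4 * R * (cr * R) - + 2 * (cr * R)) * (ci * P) * (P - R - + 1)
        ≡⟨ cong₂ (λ u v → R * u * (cr * R) * (P - R + + 1) - P * v * (ci * P) * (P - R - + 1))
                 (isolate hi) (isolate hr) ⟨
      R * (P * bi') * (cr * R) * (P - R + + 1) - P * (R * br') * (ci * P) * (P - R - + 1)
        ≡⟨ solve 6 (λ P R ci cr bi' br' →
             R :* (P :* bi') :* (cr :* R) :* (P :- R :+ con (+ 1)) :- P :* (R :* br') :* (ci :* P) :* (P :- R :- con (+ 1))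
             := P :* (R :* (bi' :* (cr :* R) :* (con (+ 2) :* P :- (P :+ R :- con (+ 1)))
                            :- (ci :* P) :* br' :* (con (+ 2) :* (P :- con (+ 1)) :- (P :+ R :- con (+ 1))))))
             refl P R ci cr bi' br' ⟩
      P * (R * (bi' * (cr * R) * (+ 2 * P - N) - ci * P * br' * (+ 2 * (P - + 1) - N))) ∎))
    where
    open ≡-Reasoning
    N = P + R - + 1
    isolate : ∀ {x y z} → x + y ≡ z → x ≡ z - y
    isolate {x} {y} x+y≡z = trans (solve 2 (λ x y → x := x :+ y :- y) refl x y) (cong (_- y) x+y≡z)

  b : ℕ → ℤ
  b i = + centralBinomial i

  b-step : ∀ i → + suc i * b (suc i) + + 2 * b i ≡ + 4 * + suc i * b i
  b-step i = begin
    + suc i * b (suc i) + + 2 * b i                ≡⟨ cong₂ _+_ (pos-* (suc i) (centralBinomial (suc i))) (pos-* 2 (centralBinomial i)) ⟨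
    + (suc i ℕ.* centralBinomial (suc i)) + + (2 ℕ.* centralBinomial i)
      ≡⟨ cong (λ z → + z + + (2 ℕ.* centralBinomial i)) (centralBinomial-step i) ⟩
    + (2 ℕ.* suc (2 ℕ.* i) ℕ.* centralBinomial i) + + (2 ℕ.* centralBinomial i)
      ≡⟨ cong₂ _+_ (trans (pos-* (2 ℕ.* suc (2 ℕ.* i)) _) (cong (_* b i) (trans (pos-* 2 (suc (2 ℕ.* i)))
                     (cong (λ z → + 2 * (+ 1 + z)) (pos-* 2 i))))) (pos-* 2 (centralBinomial i)) ⟩
    + 2 * (+ 1 + + 2 * + i) * b i + + 2 * b i
      ≡⟨ solve 2 (λ x y → con (+ 2) :* (con (+ 1) :+ con (+ 2) :* x) :* y :+ con (+ 2) :* y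
                          := con (+ 4) :* (con (+ 1) :+ x) :* y) refl (+ i) (b i) ⟩
    + 4 * + suc i * b i ∎
    where open ≡-Reasoning

  -- Proof by strong induction: multiplying the recurrence by 2N(N+1), N = n+1,
  -- each summand becomes a difference G(i+1) - G(i) with
  -- G(j) = C(2j,j)·C(2N-2j,N-j)·(2j - N), and the sum telescopes to 2N·C(2N,N).
  module ClosedForm (c : ℕ → ℕ) (c-zero : c 0 ≡ 1)
                    (c-rec : ∀ n → c (suc n) ≡ sumℕ n (λ i → c i ℕ.* c (n ∸ i))) where

    cz : ℕ → ℤ
    cz i = + c i

    step : ∀ n → (∀ i → i ≤ n → c i ℕ.* suc i ≡ centralBinomial i) →
           c (suc n) ℕ.* suc (suc n) ≡ centralBinomial (suc n)
    step n IH = +-injective (begin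
      + (c (suc n) ℕ.* suc (suc n)) ≡⟨ pos-* (c (suc n)) (suc (suc n)) ⟩
      cz (suc n) * (+ 1 + N)        ≡⟨ *-cancelˡ-≡ (+ 2) _ _ (*-cancelˡ-≡ N _ _ key) ⟩
      b (suc n)                     ∎)
      where
      open ≡-Reasoning
      N = + suc n
      G : ℕ → ℤ
      G j = b j * b (suc n ∸ j) * (+ 2 * + j - N)
      b≡cz : ∀ i → i ≤ n → b i ≡ cz i * + suc i
      b≡cz i i≤n = trans (cong +_ (sym (IH i i≤n))) (pos-* (c i) (suc i))
      term : ∀ i → i ≤ n → + 2 * N * (+ 1 + N) * (cz i * cz (n ∸ i)) ≡ G (suc i) - G i
      term i i≤n = trans
        (telescoping-term (+ suc i) (+ suc r) N (+ i) (cz i) (cz r) (b i) (b r) (b (suc i)) (b (suc r))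
          N≡ (solve 1 (λ x → x := con (+ 1) :+ x :- con (+ 1)) refl (+ i))
          (b≡cz i i≤n) (b≡cz r (ℕ.m∸n≤m n i)) (b-step i) (b-step r))
        (cong (λ z → b (suc i) * b r * (+ 2 * + suc i - N) - b i * b z * (+ 2 * + i - N)) (sym (ℕ.+-∸-assoc 1 i≤n)))
        where
        r = n ∸ i
        N≡ : N ≡ + suc i + + suc r - + 1
        N≡ = trans (cong (λ z → + suc z) (sym (ℕ.m+[n∸m]≡n i≤n)))
               (trans (pos-+ (suc i) r) (solve 2 (λ a x → a :+ x := a :+ (con (+ 1) :+ x) :- con (+ 1)) refl (+ suc i) (+ r)))
      recurrence : cz (suc n) ≡ sumTo n (λ i → cz i * cz (n ∸ i))
      recurrence = trans (cong +_ (c-rec n))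
        (trans (sumℕ-sumTo n _) (sumTo-cong n (λ i _ → pos-* (c i) (c (n ∸ i)))))
      -- the telescoped sum, using C(0,0) = 1
      ends : G (suc n) - G 0 ≡ + 2 * N * b (suc n)
      ends rewrite ℕ.n∸n≡0 n =
        solve 2 (λ N x → x :* con (+ 1) :* (con (+ 2) :* N :- N) :- con (+ 1) :* x :* (con (+ 0) :- N)
                         := con (+ 2) :* N :* x) refl N (b (suc n))
      key : N * (+ 2 * (cz (suc n) * (+ 1 + N))) ≡ N * (+ 2 * b (suc n))
      key = begin
        N * (+ 2 * (cz (suc n) * (+ 1 + N)))
          ≡⟨ solve 2 (λ N x → N :* (con (+ 2) :* (x :* (con (+ 1) :+ N))) := con (+ 2) :* N :* (con (+ 1) :+ N) :* x) refl N (cz (suc n)) ⟩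
        + 2 * N * (+ 1 + N) * cz (suc n)                          ≡⟨ cong (+ 2 * N * (+ 1 + N) *_) recurrence ⟩
        + 2 * N * (+ 1 + N) * sumTo n (λ i → cz i * cz (n ∸ i))   ≡⟨ sumTo-scale n (+ 2 * N * (+ 1 + N)) (λ i → cz i * cz (n ∸ i)) ⟨
        sumTo n (λ i → + 2 * N * (+ 1 + N) * (cz i * cz (n ∸ i))) ≡⟨ sumTo-cong n term ⟩
        sumTo n (λ i → G (suc i) - G i)                           ≡⟨ telescope n G ⟩
        G (suc n) - G 0                                           ≡⟨ ends ⟩
        + 2 * N * b (suc n)
          ≡⟨ solve 2 (λ N x → con (+ 2) :* N :* x := N :* (con (+ 2) :* x)) refl N (b (suc n)) ⟩
        N * (+ 2 * b (suc n))                                     ∎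

    below : ∀ n i → i ≤ n → c i ℕ.* suc i ≡ centralBinomial i
    below zero    zero    z≤n = cong (ℕ._* 1) c-zero
    below (suc n) i       i≤1+n with ℕ.m≤n⇒m<n∨m≡n i≤1+n
    ... | inj₁ (s≤s i≤n) = below n i i≤n
    ... | inj₂ refl      = step n (below n)

    catalan-closed-form : ∀ n → c n ≡ catalan n
    catalan-closed-form n = trans (sym (m*n/n≡m (c n) (suc n))) (cong (ℕ._/ suc n) (below n n ℕ.≤-refl))

module SeriesAlgebra where

  open IntegerSums
  open import Data.Nat as ℕ using (zero; suc; _∸_; _≤_; _<_; z≤n; s≤s)
  import Data.Nat.Properties as ℕ
  open import Data.Integer using (+_; _+_; _*_; _-_)
  open import Data.Integer.Properties using (*-zeroʳ; *-identityʳ; *-identityˡ; +-identityʳ; +-inverseʳ)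
  open import Data.Integer.Solver using (module +-*-Solver)
  open import Data.Empty using (⊥-elim)
  open import Relation.Binary.PropositionalEquality
  open +-*-Solver

  ∸-suc : ∀ {n i} → i < n → n ∸ i ≡ suc (n ∸ suc i)
  ∸-suc {suc n} {zero}  _         = refl
  ∸-suc {suc n} {suc i} (s≤s i<n) = ∸-suc i<n

  oneˢ-sucˡ : ∀ a c → oneˢ (suc a) c ≡ + 0
  oneˢ-sucˡ a zero    = refl
  oneˢ-sucˡ a (suc c) = refl

  oneˢ-sucʳ : ∀ a c → oneˢ a (suc c) ≡ + 0
  oneˢ-sucʳ zero    c = refl
  oneˢ-sucʳ (suc a) c = refl

  tˢ-sucʳ : ∀ a c → tˢ a (suc c) ≡ + 0
  tˢ-sucʳ zero          c = refl
  tˢ-sucʳ (suc zero)    c = refl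
  tˢ-sucʳ (suc (suc a)) c = refl

  *ˢ-oneˢ : ∀ F n m → (F *ˢ oneˢ) n m ≡ F n m
  *ˢ-oneˢ F n m = begin
    sumTo n (λ i → sumTo m (λ j → F i j * oneˢ (n ∸ i) (m ∸ j)))
      ≡⟨ sumTo-single n n ℕ.≤-refl (λ i i≤n i≢n → sumTo-zero m (λ j _ →
           trans (cong (λ z → F i j * oneˢ z (m ∸ j)) (∸-suc (ℕ.≤∧≢⇒< i≤n i≢n))) (*-zeroʳ (F i j)))) ⟩
    sumTo m (λ j → F n j * oneˢ (n ∸ n) (m ∸ j))
      ≡⟨ sumTo-single m m ℕ.≤-refl (λ j j≤m j≢m →
           trans (cong (λ z → F n j * oneˢ (n ∸ n) z) (∸-suc (ℕ.≤∧≢⇒< j≤m j≢m)))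
                 (trans (cong (F n j *_) (oneˢ-sucʳ (n ∸ n) _)) (*-zeroʳ (F n j)))) ⟩
    F n m * oneˢ (n ∸ n) (m ∸ m)   ≡⟨ cong₂ (λ a c → F n m * oneˢ a c) (ℕ.n∸n≡0 n) (ℕ.n∸n≡0 m) ⟩
    F n m * + 1                    ≡⟨ *-identityʳ (F n m) ⟩
    F n m                          ∎
    where open ≡-Reasoning

  *ˢ-distrib-ˢ : ∀ F A B n m → (F *ˢ (A -ˢ B)) n m ≡ (F *ˢ A) n m - (F *ˢ B) n m
  *ˢ-distrib-ˢ F A B n m = trans
    (sumTo-cong n (λ i _ → trans (sumTo-cong m (λ j _ →
       solve 3 (λ f a b → f :* (a :- b) := f :* a :- f :* b) refl (F i j) (A (n ∸ i) (m ∸ j)) (B (n ∸ i) (m ∸ j))))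
       (sumTo-sub m _ _)))
    (sumTo-sub n _ _)

  tˢ-*ˢ-zero : ∀ G m → (tˢ *ˢ G) 0 m ≡ + 0
  tˢ-*ˢ-zero G m = sumTo-zero m (λ _ _ → refl)

  tˢ-*ˢ-suc : ∀ G n m → (tˢ *ˢ G) (suc n) m ≡ G n m
  tˢ-*ˢ-suc G n m = begin
    sumTo (suc n) (λ i → sumTo m (λ j → tˢ i j * G (suc n ∸ i) (m ∸ j)))
      ≡⟨ sumTo-cong (suc n) (λ i _ → sumTo-single m 0 z≤n (λ j _ j≢0 → only-j≡0 i j j≢0)) ⟩
    sumTo (suc n) (λ i → tˢ i 0 * G (suc n ∸ i) m)
      ≡⟨ sumTo-single (suc n) 1 (s≤s z≤n) (λ i _ i≢1 → only-i≡1 i i≢1) ⟩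
    + 1 * G n m ≡⟨ *-identityˡ (G n m) ⟩
    G n m ∎
    where
    open ≡-Reasoning
    only-j≡0 : ∀ i j → j ≢ 0 → tˢ i j * G (suc n ∸ i) (m ∸ j) ≡ + 0
    only-j≡0 i zero    j≢0 = ⊥-elim (j≢0 refl)
    only-j≡0 i (suc j) _   = cong (_* G (suc n ∸ i) (m ∸ suc j)) (tˢ-sucʳ i j)
    only-i≡1 : ∀ i → i ≢ 1 → tˢ i 0 * G (suc n ∸ i) m ≡ + 0
    only-i≡1 zero          _   = refl
    only-i≡1 (suc zero)    i≢1 = ⊥-elim (i≢1 refl)
    only-i≡1 (suc (suc i)) _   = refl

  *ˢ-tˢ-zero : ∀ F G m → (F *ˢ (tˢ *ˢ G)) 0 m ≡ + 0
  *ˢ-tˢ-zero F G m = sumTo-zero m (λ j _ → trans (cong (F 0 j *_) (tˢ-*ˢ-zero G (m ∸ j))) (*-zeroʳ (F 0 j)))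

  *ˢ-tˢ-suc : ∀ F G n m → (F *ˢ (tˢ *ˢ G)) (suc n) m ≡ (F *ˢ G) n m
  *ˢ-tˢ-suc F G n m = begin
    sumTo n (λ i → sumTo m (λ j → F i j * (tˢ *ˢ G) (suc n ∸ i) (m ∸ j)))
      + sumTo m (λ j → F (suc n) j * (tˢ *ˢ G) (n ∸ n) (m ∸ j))
      ≡⟨ cong₂ _+_ (sumTo-cong n (λ i i≤n → sumTo-cong m (λ j _ → cong (F i j *_) (shifted i j i≤n)))) last-vanishes ⟩
    (F *ˢ G) n m + + 0 ≡⟨ +-identityʳ _ ⟩
    (F *ˢ G) n m       ∎
    where
    open ≡-Reasoning
    shifted : ∀ i j → i ≤ n → (tˢ *ˢ G) (suc n ∸ i) (m ∸ j) ≡ G (n ∸ i) (m ∸ j)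
    shifted i j i≤n = trans (cong (λ z → (tˢ *ˢ G) z (m ∸ j)) (ℕ.+-∸-assoc 1 i≤n)) (tˢ-*ˢ-suc G (n ∸ i) (m ∸ j))
    last-vanishes : sumTo m (λ j → F (suc n) j * (tˢ *ˢ G) (n ∸ n) (m ∸ j)) ≡ + 0
    last-vanishes = sumTo-zero m (λ j _ →
      trans (cong (λ z → F (suc n) j * (tˢ *ˢ G) z (m ∸ j)) (ℕ.n∸n≡0 n))
            (trans (cong (F (suc n) j *_) (tˢ-*ˢ-zero G (m ∸ j))) (*-zeroʳ (F (suc n) j))))

  inverse-of-recurrence : ∀ F G → (∀ m → F 0 m ≡ oneˢ 0 m) → (∀ n m → F (suc n) m ≡ (F *ˢ G) n m) →
                          (F *ˢ (oneˢ -ˢ (tˢ *ˢ G))) ≈ˢ oneˢ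
  inverse-of-recurrence F G F₀ F-rec n m = begin
    (F *ˢ (oneˢ -ˢ (tˢ *ˢ G))) n m          ≡⟨ *ˢ-distrib-ˢ F oneˢ (tˢ *ˢ G) n m ⟩
    (F *ˢ oneˢ) n m - (F *ˢ (tˢ *ˢ G)) n m  ≡⟨ cong (_- (F *ˢ (tˢ *ˢ G)) n m) (*ˢ-oneˢ F n m) ⟩
    F n m - (F *ˢ (tˢ *ˢ G)) n m            ≡⟨ by-degree n ⟩
    oneˢ n m                                ∎
    where
    open ≡-Reasoning
    by-degree : ∀ n → F n m - (F *ˢ (tˢ *ˢ G)) n m ≡ oneˢ n m
    by-degree zero    = begin
      F 0 m - (F *ˢ (tˢ *ˢ G)) 0 m ≡⟨ cong (F 0 m -_) (*ˢ-tˢ-zero F G m) ⟩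
      F 0 m - + 0                  ≡⟨ +-identityʳ (F 0 m) ⟩
      F 0 m                        ≡⟨ F₀ m ⟩
      oneˢ 0 m                     ∎
    by-degree (suc n) = begin
      F (suc n) m - (F *ˢ (tˢ *ˢ G)) (suc n) m ≡⟨ cong₂ _-_ (F-rec n m) (*ˢ-tˢ-suc F G n m) ⟩
      (F *ˢ G) n m - (F *ˢ G) n m              ≡⟨ +-inverseʳ ((F *ˢ G) n m) ⟩
      + 0                                      ≡⟨ oneˢ-sucˡ n m ⟨
      oneˢ (suc n) m                           ∎

module Q132Identities where

  open import Data.Nat using (suc; _*_; _∸_; _≡ᵇ_)
  open import Data.Bool using (true; false)
  open import Data.Integer using (+_)
  open import Data.Integer.Properties using (pos-*)
  open import Relation.Binary.PropositionalEquality using (_≡_; refl; cong; trans; module ≡-Reasoning)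
  open NatSums using (sumℕ)
  open Coefficients
  open IntegerSums
  open CatalanClosedForm
  open SeriesAlgebra

  -- Q^{(k,0,0,0)} has constant term 1 (the empty permutation).
  Q-constant : ∀ k m → Q132 k 0 0 0 0 m ≡ oneˢ 0 m
  Q-constant k 0       = refl
  Q-constant k (suc m) = refl

  Q-recurrence : ∀ k n m → Q132 (suc k) 0 0 0 (suc n) m ≡ (Q132 (suc k) 0 0 0 *ˢ Q132 k 0 0 0) n m
  Q-recurrence k n m = begin
    + coeff (suc k) (suc n) m                                                ≡⟨ cong +_ (coeff-recurrence k n m) ⟩
    + sumℕ n (λ i → sumℕ m (λ j → coeff (suc k) i j * coeff k (n ∸ i) (m ∸ j))) ≡⟨ sumℕ-sumTo n _ ⟩
    sumTo n (λ i → + sumℕ m (λ j → coeff (suc k) i j * coeff k (n ∸ i) (m ∸ j)))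
      ≡⟨ sumTo-cong n (λ i _ → trans (sumℕ-sumTo m _)
                                     (sumTo-cong m (λ j _ → pos-* (coeff (suc k) i j) (coeff k (n ∸ i) (m ∸ j))))) ⟩
    (Q132 (suc k) 0 0 0 *ˢ Q132 k 0 0 0) n m                                 ∎
    where open ≡-Reasoning

  size-catalan : ∀ n → size n ≡ catalan n
  size-catalan = ClosedForm.catalan-closed-form size refl size-recurrence

  Q₀-is-C[xt] : Q132 0 0 0 0 ≈ˢ Cxt
  Q₀-is-C[xt] n m with n ≡ᵇ m | coeff-zero n m
  ... | true  | coeff≡size = cong +_ (trans coeff≡size (size-catalan n))
  ... | false | coeff≡0    = cong +_ coeff≡0

  Q-inverse : ∀ k → (Q132 (suc k) 0 0 0 *ˢ (oneˢ -ˢ (tˢ *ˢ Q132 k 0 0 0))) ≈ˢ oneˢ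
  Q-inverse k = inverse-of-recurrence (Q132 (suc k) 0 0 0) (Q132 k 0 0 0) (Q-constant (suc k)) (Q-recurrence k)

open Q132Identities using (Q₀-is-C[xt]; Q-inverse)

theorem6 : (Q132 0 0 0 0 ≈ˢ Cxt)
           × ((k : ℕ) → (Q132 (suc k) 0 0 0 *ˢ (oneˢ -ˢ (tˢ *ˢ Q132 k 0 0 0))) ≈ˢ oneˢ)
theorem6 = Q₀-is-C[xt] , Q-inverse
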